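{- Let $\pi$ be a non-decreasing parking function of length $n$, and let $I=(i_1,\ldots,i_p)$ be the composition obtained by discarding the zeros of the evaluation vector of $\pi$. Then $${\bf R}_\pi*{\bf J}_n=j(R_I),$$ and this element equals ${\bf R}_{\pi_I}$, where $\pi_I=1^{i_1}(i_1+1)^{i_2}(i_1+i_2+1)^{i_3}\cdots(i_1+\cdots+i_{p-1}+1)^{i_p}$ is the unique non-decreasing word whose evaluation vector is the fully unpacked evaluation vector of $\pi$.
   Context: A parking function of length $n$ is a word ${\bf a}=a_1\cdots a_n$ of positive integers whose non-decreasing rearrangement ${\bf a}^\uparrow=a'_1\cdots a'_n$ satisfies $a'_i\le i$. Parkization: for a word $w=w_1\cdots w_n$ over a totally ordered set $B$ in which every element has an immediate successor, let $\delta(x,y)\in\mathbb{N}\cup\{\infty\}$ ($x<y$) be the number of successor steps from $x$ to $y$ ($\infty$ if never reached); with distinct letters $b_1<\cdots<b_k$ of $w$ set $p(b_1)=1$, $p(b_{j+1})=\min(p(b_j)+\delta(b_j,b_{j+1}),1+\#\{i:w_i\le b_j\})$, and ${\rm Park}(w)=p(w_1)\cdots p(w_n)$ (for integer words $\delta(x,y)=y-x$). ${\bf PQSym}$ has basis $({\bf F}_{\bf a})$ over all parking functions, product ${\bf F}_{{\bf a}'}{\bf F}_{{\bf a}''}=\sum_{{\bf a}\in{\bf a}'\sqcup\!\sqcup({\bf a}''[k])}{\bf F}_{\bf a}$ ($k$ the length of ${\bf a}'$, $v[k]$ adds $k$ to each letter, shuffle with multiplicity), and on degree $n$ the internal product ${\bf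 F}_{{\bf a}'}*{\bf F}_{{\bf a}''}={\bf F}_{{\rm Park}({\bf a}'\otimes{\bf a}'')}$, where ${\bf a}'\otimes{\bf a}''=(a'_1,a''_1)\cdots(a'_n,a''_n)$ over $\mathbb{Z}_{>0}^2$ with lexicographic order (successor of $(i,j)$ is $(i,j+1)$). ${\bf P}^\pi=\sum_{{\bf a}^\uparrow=\pi}{\bf F}_{\bf a}$ for $\pi$ non-decreasing parking function, ${\bf J}_m={\bf P}^{(1^m)}$. The evaluation vector ${\rm Ev}(w)$ of a word over positive integers is $(|w|_1,|w|_2,\ldots,|w|_{N})$ up to its largest letter $N$; the fully unpacked evaluation vector of $w$ is obtained from the composition $(c_1,\ldots,c_p)$ of nonzero entries of ${\rm Ev}(w)$ by inserting $c_k-1$ zeros after each entry $c_k$ except the last. Catalan ribbons: the successors of a non-decreasing parking function $\pi$ are the non-decreasing parking functions whose evaluation is obtained from ${\rm Ev}(\pi)$ by choosing two nonzero entries with only zeros between them, replacing the left one by their sum and the right one by $0$; $\preceq$ is the reflexive-transitive closure of this relation, and ${\bf R}_\pi$ is defined by ${\bf P}^\pi=\sum_{\pi'\succeq\pi}{\bf R}_{\pi'}$. ${\bf Sym}$ is the free associative algebra on $S_1,S_2,\ldots$, $S^I=S_{i_1}\cdots S_{i_p}$, with ribbons $R_I$ defined by $S^I=\sum_{J}R_J$ over compositions $J$ coarser than $I$ (obtained by adding adjacent parts, $J=I$ included); $j:{\bf Sym}\to{\bf PQSym}$ is the algebra morphism $S_n\mapsto{\bf J}_n$. -}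

module Defs where

open import Data.Nat using (ℕ; zero; suc; _+_; _∸_; _≤_; _⊔_; _⊓_)
import Data.Nat as ℕ
open import Data.Integer using (ℤ; 0ℤ; 1ℤ; -_) renaming (_+_ to _+ℤ_; _*_ to _*ℤ_)
open import Data.List using (List; []; _∷_; _++_; map; concat; concatMap; filter; length; replicate; foldr; applyUpTo; zipWith; deduplicate)
open import Data.List.Properties using (≡-dec)
open import Data.List.Relation.Unary.Linked using (Linked)
open import Data.Maybe using (Maybe; just; nothing)
open import Data.Product using (_×_; _,_; proj₁; proj₂)
open import Data.Bool using (Bool; true; false; _∧_; _∨_; if_then_else_)
open import Data.Unit using (⊤)
open import Relation.Nullary using (¬?; does)
open import Relation.Binary.PropositionalEquality using (_≡_)

Word : Set
Word = List ℕ

_≟W_ : (u v : Word) → Relation.Nullary.Dec (u ≡ v)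
_≟W_ = ≡-dec ℕ._≟_

ParkCond : ℕ → Word → Set
ParkCond k [] = ⊤
ParkCond k (x ∷ xs) = (1 ≤ x) × (x ≤ k) × ParkCond (suc k) xs

IsNDPF : Word → Set
IsNDPF π = Linked _≤_ π × ParkCond 1 π

count : ℕ → Word → ℕ
count k w = length (filter (λ x → x ℕ.≟ k) w)

maxL : Word → ℕ
maxL = foldr _⊔_ 0

Ev : Word → List ℕ
Ev w = applyUpTo (λ i → count (suc i) w) (maxL w)

fromEvFrom : ℕ → List ℕ → Word
fromEvFrom k [] = []
fromEvFrom k (e ∷ es) = replicate e k ++ fromEvFrom (suc k) es

fromEv : List ℕ → Word
fromEv = fromEvFrom 1

nonzeros : List ℕ → List ℕ
nonzeros = filter (λ x → ¬? (x ℕ.≟ 0))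

unpack : List ℕ → List ℕ
unpack [] = []
unpack (c ∷ []) = c ∷ []
unpack (c ∷ d ∷ cs) = c ∷ replicate (c ∸ 1) 0 ++ unpack (d ∷ cs)

piI : List ℕ → Word
piI I = fromEv (unpack I)

absorb : List ℕ → Maybe (ℕ × List ℕ)
absorb [] = nothing
absorb (zero ∷ v) with absorb v
... | nothing = nothing
... | just (y , v') = just (y , 0 ∷ v')
absorb (suc y ∷ v) = just (suc y , 0 ∷ v)

succV : List ℕ → List (List ℕ)
succV [] = []
succV (zero ∷ v) = map (0 ∷_) (succV v)
succV (suc x ∷ v) with absorb v
... | nothing = map (suc x ∷_) (succV v)
... | just (y , v') = ((suc x + y) ∷ v') ∷ map (suc x ∷_) (succV v)

succW : Word → List Word
succW π = map fromEv (succV (Ev π))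

reach : ℕ → Word → List Word
reach zero π = π ∷ []
reach (suc f) π = π ∷ concatMap (reach f) (succW π)

strictUp : ℕ → Word → List Word
strictUp f π = filter (λ u → ¬? (u ≟W π)) (deduplicate _≟W_ (concatMap (reach f) (succW π)))

-- Formal linear combinations (elements of PQSym / Sym)

Lin : Set
Lin = List (ℤ × Word)

coeff : Lin → Word → ℤ
coeff [] w = 0ℤ
coeff ((c , a) ∷ x) w = if does (a ≟W w) then c +ℤ coeff x w else coeff x w

infix 4 _≈_
_≈_ : Lin → Lin → Set
x ≈ y = ∀ w → coeff x w ≡ coeff y w

F : Word → Lin
F a = (1ℤ , a) ∷ []

neg : Lin → Lin
neg = map (λ { (c , a) → (- c , a) })

insertAll : ℕ → Word → List Word
insertAll x [] = (x ∷ []) ∷ []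
insertAll x (y ∷ ys) = (x ∷ y ∷ ys) ∷ map (y ∷_) (insertAll x ys)

perms : Word → List Word
perms [] = [] ∷ []
perms (x ∷ xs) = concatMap (insertAll x) (perms xs)

P : Word → Lin
P π = map (λ a → (1ℤ , a)) (deduplicate _≟W_ (perms π))

J : ℕ → Lin
J m = P (replicate m 1)

-- Catalan ribbons R_π, defined by P^π = Σ_{π' ⪰ π} R_π'
-- i.e. R_π = P^π − Σ_{π' ≻ π} R_π'  (recursion with fuel)

Rf : ℕ → Word → Lin
Rf zero π = P π
Rf (suc f) π = P π ++ neg (concatMap (Rf f) (strictUp f π))

Rib : Word → Lin
Rib π = Rf (length π) π

shift : ℕ → Word → Word
shift k = map (k +_)

shuffle : Word → Word → List Word
shuffle [] v = v ∷ []
shuffle (x ∷ u) [] = (x ∷ u) ∷ []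
shuffle (x ∷ u) (y ∷ v) = map (x ∷_) (shuffle u (y ∷ v)) ++ map (y ∷_) (shuffle (x ∷ u) v)

infixl 7 _·_
_·_ : Lin → Lin → Lin
x · y = concatMap (λ { (c , a) → concatMap (λ { (d , b) →
          map (λ w → (c *ℤ d , w)) (shuffle a (shift (length a) b)) }) y }) x

module Parkization {A : Set} (_≤b_ : A → A → Bool) (_≟A_ : (x y : A) → Relation.Nullary.Dec (x ≡ y))
                   (δ : A → A → Maybe ℕ) where
  -- δ x y : number of successor steps from x to y, nothing = ∞

  insertS : A → List A → List A
  insertS x [] = x ∷ []
  insertS x (y ∷ ys) = if does (x ≟A y) then y ∷ ys
                       else (if x ≤b y then x ∷ y ∷ ys else y ∷ insertS x ys)

  distinctSorted : List A → List A
  distinctSorted = foldr insertS []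

  cntLeq : List A → A → ℕ
  cntLeq w b = length (filter (λ x → Data.Bool._≟_ (x ≤b b) true) w)

  nextP : List A → A → ℕ → A → ℕ
  nextP w b p c with δ b c
  ... | just d = (p + d) ⊓ (1 + cntLeq w b)
  ... | nothing = 1 + cntLeq w b

  assignFrom : List A → A → ℕ → List A → List (A × ℕ)
  assignFrom w b p [] = []
  assignFrom w b p (c ∷ cs) = (c , nextP w b p c) ∷ assignFrom w c (nextP w b p c) cs

  assign : List A → List (A × ℕ)
  assign w with distinctSorted w
  ... | [] = []
  ... | b ∷ bs = (b , 1) ∷ assignFrom w b 1 bs

  look : List (A × ℕ) → A → ℕ
  look [] x = 0
  look ((y , p) ∷ t) x = if does (x ≟A y) then p else look t x

  Park : List A → List ℕ
  Park w = map (look (assign w)) w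

-- pairs with lexicographic order; successor of (i,j) is (i,j+1)
lexLeq : ℕ × ℕ → ℕ × ℕ → Bool
lexLeq (i , j) (i' , j') = does (i ℕ.<? i') ∨ (does (i ℕ.≟ i') ∧ does (j ℕ.≤? j'))

_≟P_ : (x y : ℕ × ℕ) → Relation.Nullary.Dec (x ≡ y)
_≟P_ = Data.Product.Properties.≡-dec ℕ._≟_ ℕ._≟_
  where import Data.Product.Properties

δPair : ℕ × ℕ → ℕ × ℕ → Maybe ℕ
δPair (i , j) (i' , j') = if does (i ℕ.≟ i') then just (j' ∸ j) else nothing

ParkPair : List (ℕ × ℕ) → Word
ParkPair = Parkization.Park lexLeq _≟P_ δPair

zipPair : Word → Word → List (ℕ × ℕ)
zipPair = zipWith _,_

infixl 7 _✶_
_✶_ : Lin → Lin → Lin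
x ✶ y = concatMap (λ { (c , a) → concatMap (λ { (d , b) →
          if does (length a ℕ.≟ length b) then (c *ℤ d , ParkPair (zipPair a b)) ∷ [] else [] }) y }) x

-- Sym: elements as formal combinations of compositions S^I,
-- ribbons R_I via S^I = Σ_{J coarser than I} R_J

coarseFrom : ℕ → List ℕ → List (List ℕ)
coarseFrom x [] = (x ∷ []) ∷ []
coarseFrom x (y ∷ r) = map (x ∷_) (coarseFrom y r) ++ coarseFrom (x + y) r

coarsenings : List ℕ → List (List ℕ)
coarsenings [] = [] ∷ []
coarsenings (x ∷ r) = coarseFrom x r

strictCoarse : List ℕ → List (List ℕ)
strictCoarse I = filter (λ K → ¬? (K ≟W I)) (coarsenings I)

-- R_I expressed in the S-basis (an element of Lin whose "words" are compositions I, standing for S^I)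
RSf : ℕ → List ℕ → Lin
RSf zero I = (1ℤ , I) ∷ []
RSf (suc f) I = (1ℤ , I) ∷ neg (concatMap (RSf f) (strictCoarse I))

RSym : List ℕ → Lin
RSym I = RSf (length I) I

-- j : Sym → PQSym, S_n ↦ J_n, algebra morphism: S^I ↦ J_{i1} ··· J_{ip}
jS : List ℕ → Lin
jS [] = F []
jS (i ∷ I) = J i · jS I

j : Lin → Lin
j = concatMap (λ { (c , I) → map (λ { (d , w) → (c *ℤ d , w) }) (jS I) })

-- Describe a non-decreasing parking function by the blocks of its evaluation vector: pairs (c , z),
-- a nonzero entry c followed by z zeros. A successor step of the Catalan-ribbon order merges two
-- adjacent blocks, so π ↦ nonzeros (Ev π) matches the strict upper set of π with the strict
-- coarsenings of its composition I. Hence R_π and R_I obey the same triangular recursion, and a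
-- linear map Φ with Φ (P^π) = j (S^I) on a coarsening-closed class of π sends R_π to j (R_I).
-- Both identities are instances. For Φ = _✶ J_n: parkizing a ⊗ 1ⁿ replaces each letter by one plus
-- the number of smaller letters, so P^π ✶ J_n = P^{π_I}; and P^{π_I} = J_{i₁} ⋯ J_{i_p}, since w
-- occurs in J_i · P^{π_I′} exactly when its ones form 1^i and its other letters, lowered by i, form a
-- rearrangement of π_I′. For Φ = id the class consists of the words π_I themselves.

module Submission where

open import Defs
open import Data.Bool using (true; false; if_then_else_; T) renaming (_≟_ to _≟ᵇ_)
open import Data.Empty using (⊥; ⊥-elim)
open import Data.Integer using (ℤ; 0ℤ; 1ℤ; -_) renaming (_+_ to _+ℤ_; _*_ to _*ℤ_)
import Data.Integer.Properties as ℤₚ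
import Data.Integer.Solver as ℤSolver
open import Data.List using (List; []; _∷_; _++_; map; concatMap; length; foldr; replicate; filter; applyUpTo; deduplicate)
import Data.List.Properties as Listₚ
open import Data.List.Membership.Propositional using (_∈_; find; lose)
open import Data.List.Membership.Propositional.Properties
  using (∈-map⁺; ∈-map⁻; ∈-++⁺ˡ; ∈-++⁺ʳ; ∈-++⁻; ∈-concatMap⁺; ∈-concatMap⁻; ∈-filter⁺; ∈-filter⁻; ∈-deduplicate⁺; ∈-deduplicate⁻; ∈-∃++)
open import Data.List.Membership.Propositional.Properties.WithK using (unique∧set⇒bag)
import Data.List.Membership.DecPropositional as DecMembership
open import Data.List.Relation.Binary.BagAndSetEquality using (∼bag⇒↭)
open import Data.List.Relation.Binary.Permutation.Propositional using (_↭_; ↭-refl; ↭-sym; ↭-trans; ↭-prep; ↭-swap; ↭⇒↭ₛ)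
import Data.List.Relation.Binary.Permutation.Propositional.Properties as ↭ₚ
import Data.List.Relation.Binary.Permutation.Setoid.Properties as ↭ₛₚ
open import Data.List.Relation.Unary.All as All using (All; []; _∷_; all?; tabulate)
import Data.List.Relation.Unary.All.Properties as Allₚ
open import Data.List.Relation.Unary.AllPairs using (AllPairs; []; _∷_)
import Data.List.Relation.Unary.AllPairs.Properties as AllPairsₚ
open import Data.List.Relation.Unary.Any as Any using (here; there)
import Data.List.Relation.Unary.Any.Properties as Anyₚ
import Data.List.Relation.Unary.Linked.Properties as Linkedₚ
open import Data.List.Relation.Unary.Unique.Propositional using (Unique)
import Data.List.Relation.Unary.Unique.Propositional.Properties as Uniqueₚ
import Data.List.Relation.Unary.Unique.DecPropositional.Properties as UniqueDecₚ
open import Data.Maybe using (just; nothing)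
import Data.Maybe as Maybe
open import Data.Nat as ℕ using (ℕ; zero; suc; _+_; _∸_; _≤_; _<_; z≤n; s≤s; _⊔_)
open import Data.Nat.ListAction using (sum)
import Data.Nat.ListAction.Properties as ℕᴸₚ
import Data.Nat.Properties as ℕₚ
open import Data.Product using (_×_; _,_; proj₁; proj₂; ∃)
open import Data.Sum using (_⊎_; inj₁; inj₂)
open import Data.Unit using (⊤; tt)
open import Function.Base using (_∘_)
open import Function.Bundles using (mk⇔)
open import Relation.Binary.Definitions using (tri<; tri≈; tri>)
open import Relation.Binary.PropositionalEquality hiding (J)
open import Relation.Nullary using (Dec; does; yes; no; ¬_; ¬?)
open import Relation.Nullary.Decidable using (_×-dec_; _⊎-dec_; decidable-stable; does-⇔)

open DecMembership _≟W_ using (_∈?_)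

sumℤ : List ℤ → ℤ
sumℤ = foldr _+ℤ_ 0ℤ

sumℤ-↭ : ∀ {xs ys} → xs ↭ ys → sumℤ xs ≡ sumℤ ys
sumℤ-↭ p = ↭ₛₚ.foldr-commMonoid (setoid ℤ) ℤₚ.+-0-isCommutativeMonoid (↭⇒↭ₛ p)

sumℤ-map-cong : ∀ {A : Set} {f g : A → ℤ} (L : List A) → (∀ {a} → a ∈ L → f a ≡ g a) → sumℤ (map f L) ≡ sumℤ (map g L)
sumℤ-map-cong L h = cong sumℤ (Listₚ.map-cong-local (tabulate h))

sumℤ-map-zero : ∀ {A : Set} {f : A → ℤ} (L : List A) → (∀ {a} → a ∈ L → f a ≡ 0ℤ) → sumℤ (map f L) ≡ 0ℤ
sumℤ-map-zero [] h = refl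
sumℤ-map-zero (a ∷ L) h = cong₂ _+ℤ_ (h (here refl)) (sumℤ-map-zero L (λ m → h (there m)))

sumℤ-map-*ˡ : ∀ {A : Set} c (f : A → ℤ) L → sumℤ (map (λ a → c *ℤ f a) L) ≡ c *ℤ sumℤ (map f L)
sumℤ-map-*ˡ c f [] = sym (ℤₚ.*-zeroʳ c)
sumℤ-map-*ˡ c f (a ∷ L) = trans (cong (c *ℤ f a +ℤ_) (sumℤ-map-*ˡ c f L)) (sym (ℤₚ.*-distribˡ-+ c (f a) _))

indicator : ∀ {A : Set} → Dec A → ℤ
indicator (yes _) = 1ℤ
indicator (no _) = 0ℤ

indicator-cong : ∀ {A B : Set} (a? : Dec A) (b? : Dec B) → (A → B) → (B → A) → indicator a? ≡ indicator b?
indicator-cong (yes a) (yes b) f g = refl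
indicator-cong (yes a) (no ¬b) f g = ⊥-elim (¬b (f a))
indicator-cong (no ¬a) (yes b) f g = ⊥-elim (¬a (g b))
indicator-cong (no ¬a) (no ¬b) f g = refl

indicator-× : ∀ {A B : Set} (a? : Dec A) (b? : Dec B) → indicator (a? ×-dec b?) ≡ indicator a? *ℤ indicator b?
indicator-× (yes a) (yes b) = refl
indicator-× (yes a) (no b) = refl
indicator-× (no a) (yes b) = refl
indicator-× (no a) (no b) = refl

indicator-no : ∀ {A : Set} (a? : Dec A) → ¬ A → indicator a? ≡ 0ℤ
indicator-no (yes a) ¬a = ⊥-elim (¬a a)
indicator-no (no _) ¬a = refl

coeff-++ : ∀ x y w → coeff (x ++ y) w ≡ coeff x w +ℤ coeff y w
coeff-++ [] y w = sym (ℤₚ.+-identityˡ _)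
coeff-++ ((c , a) ∷ x) y w with does (a ≟W w)
... | true = trans (cong (c +ℤ_) (coeff-++ x y w)) (sym (ℤₚ.+-assoc c _ _))
... | false = coeff-++ x y w

coeff-neg : ∀ x w → coeff (neg x) w ≡ - coeff x w
coeff-neg [] w = refl
coeff-neg ((c , a) ∷ x) w with does (a ≟W w)
... | true = trans (cong (- c +ℤ_) (coeff-neg x w)) (sym (ℤₚ.neg-distrib-+ c _))
... | false = coeff-neg x w

coeff-concatMap : ∀ {A : Set} (g : A → Lin) L w → coeff (concatMap g L) w ≡ sumℤ (map (λ e → coeff (g e) w) L)
coeff-concatMap g [] w = refl
coeff-concatMap g (e ∷ L) w = trans (coeff-++ (g e) (concatMap g L) w) (cong (coeff (g e) w +ℤ_) (coeff-concatMap g L w))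

coeff-as-sum : ∀ y w → coeff y w ≡ sumℤ (map (λ p → proj₁ p *ℤ indicator (proj₂ p ≟W w)) y)
coeff-as-sum [] w = refl
coeff-as-sum ((d , b) ∷ y) w with b ≟W w
... | yes _ = cong₂ _+ℤ_ (sym (ℤₚ.*-identityʳ d)) (coeff-as-sum y w)
... | no _ = trans (coeff-as-sum y w) (sym (trans (cong (_+ℤ _) (ℤₚ.*-zeroʳ d)) (ℤₚ.+-identityˡ _)))

coeff-F : ∀ a w → coeff (F a) w ≡ indicator (a ≟W w)
coeff-F a w with a ≟W w
... | yes _ = refl
... | no _ = refl

sumF : List Word → Lin
sumF = map (1ℤ ,_)

multiplicity : Word → List Word → ℤ
multiplicity w L = coeff (sumF L) w

multiplicity-as-sum : ∀ w L → multiplicity w L ≡ sumℤ (map (λ a → indicator (a ≟W w)) L)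
multiplicity-as-sum w [] = refl
multiplicity-as-sum w (a ∷ L) with a ≟W w
... | yes _ = cong (1ℤ +ℤ_) (multiplicity-as-sum w L)
... | no _ = trans (multiplicity-as-sum w L) (sym (ℤₚ.+-identityˡ _))

multiplicity-unique : ∀ w D → Unique D → multiplicity w D ≡ indicator (w ∈? D)
multiplicity-unique w [] _ = refl
multiplicity-unique w (a ∷ D) (a∉D ∷ uD) with a ≟W w
... | yes refl = trans (cong (1ℤ +ℤ_) (trans (multiplicity-unique w D uD) (indicator-no (w ∈? D) (λ m → All.lookup a∉D m refl))))
                       (indicator-cong (yes (here {xs = D} refl)) (w ∈? (w ∷ D)) (λ m → m) (λ m → m))
... | no a≢w = trans (multiplicity-unique w D uD) (indicator-cong (w ∈? D) (w ∈? (a ∷ D)) there back)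
  where
  back : w ∈ a ∷ D → w ∈ D
  back (here w≡a) = ⊥-elim (a≢w (sym w≡a))
  back (there m) = m

coeff-scaled : ∀ e L w → coeff (map (e ,_) L) w ≡ e *ℤ multiplicity w L
coeff-scaled e [] w = sym (ℤₚ.*-zeroʳ e)
coeff-scaled e (v ∷ L) w with v ≟W w
... | yes _ = trans (cong (e +ℤ_) (coeff-scaled e L w))
                (sym (trans (ℤₚ.*-distribˡ-+ e 1ℤ (multiplicity w L)) (cong (_+ℤ (e *ℤ multiplicity w L)) (ℤₚ.*-identityʳ e))))
... | no _ = coeff-scaled e L w

record IsLinear (Φ : Lin → Lin) : Set where
  field
    coeff-Φ-[] : ∀ w → coeff (Φ []) w ≡ 0ℤ
    coeff-Φ-++ : ∀ x y w → coeff (Φ (x ++ y)) w ≡ coeff (Φ x) w +ℤ coeff (Φ y) w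
    coeff-Φ-neg : ∀ x w → coeff (Φ (neg x)) w ≡ - coeff (Φ x) w

  coeff-Φ-concatMap : ∀ {A : Set} (g : A → Lin) L w → coeff (Φ (concatMap g L)) w ≡ sumℤ (map (λ e → coeff (Φ (g e)) w) L)
  coeff-Φ-concatMap g [] w = coeff-Φ-[] w
  coeff-Φ-concatMap g (e ∷ L) w = trans (coeff-Φ-++ (g e) (concatMap g L) w) (cong (coeff (Φ (g e)) w +ℤ_) (coeff-Φ-concatMap g L w))

id-isLinear : IsLinear (λ x → x)
id-isLinear = record { coeff-Φ-[] = λ w → refl ; coeff-Φ-++ = coeff-++ ; coeff-Φ-neg = coeff-neg }

j-isLinear : IsLinear j
j-isLinear = record
  { coeff-Φ-[] = λ w → refl
  ; coeff-Φ-++ = λ x y w → trans (cong (λ z → coeff z w) (Listₚ.concatMap-++ _ x y)) (coeff-++ (j x) (j y) w)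
  ; coeff-Φ-neg = coeff-j-neg
  }
  where
  scale : ℤ → Lin → Lin
  scale c = map (λ { (d , w) → (c *ℤ d , w) })

  coeff-scale-neg : ∀ c x w → coeff (scale (- c) x) w ≡ - coeff (scale c x) w
  coeff-scale-neg c [] w = refl
  coeff-scale-neg c ((d , a) ∷ x) w with does (a ≟W w)
  ... | true = trans (cong₂ _+ℤ_ (sym (ℤₚ.neg-distribˡ-* c d)) (coeff-scale-neg c x w)) (sym (ℤₚ.neg-distrib-+ (c *ℤ d) _))
  ... | false = coeff-scale-neg c x w

  coeff-j-neg : ∀ x w → coeff (j (neg x)) w ≡ - coeff (j x) w
  coeff-j-neg [] w = refl
  coeff-j-neg ((c , I) ∷ x) w = begin
    coeff (scale (- c) (jS I) ++ j (neg x)) w          ≡⟨ coeff-++ (scale (- c) (jS I)) (j (neg x)) w ⟩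
    coeff (scale (- c) (jS I)) w +ℤ coeff (j (neg x)) w ≡⟨ cong₂ _+ℤ_ (coeff-scale-neg c (jS I) w) (coeff-j-neg x w) ⟩
    - coeff (scale c (jS I)) w +ℤ - coeff (j x) w       ≡⟨ ℤₚ.neg-distrib-+ (coeff (scale c (jS I)) w) (coeff (j x) w) ⟨
    - (coeff (scale c (jS I)) w +ℤ coeff (j x) w)       ≡⟨ cong -_ (coeff-++ (scale c (jS I)) (j x) w) ⟨
    - coeff (j ((c , I) ∷ x)) w                          ∎
    where open ≡-Reasoning

✶-isLinearˡ : ∀ z → IsLinear (_✶ z)
✶-isLinearˡ z = record
  { coeff-Φ-[] = λ w → refl
  ; coeff-Φ-++ = λ x y w → trans (cong (λ q → coeff q w) (Listₚ.concatMap-++ _ x y)) (coeff-++ (x ✶ z) (y ✶ z) w)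
  ; coeff-Φ-neg = coeff-✶-neg
  }
  where
  coeff-✶-neg : ∀ x w → coeff (neg x ✶ z) w ≡ - coeff (x ✶ z) w
  coeff-✶-neg [] w = refl
  coeff-✶-neg ((c , a) ∷ x) w = begin
    coeff (row (- c) z ++ neg x ✶ z) w         ≡⟨ coeff-++ (row (- c) z) (neg x ✶ z) w ⟩
    coeff (row (- c) z) w +ℤ coeff (neg x ✶ z) w ≡⟨ cong₂ _+ℤ_ (coeff-row-neg z) (coeff-✶-neg x w) ⟩
    - coeff (row c z) w +ℤ - coeff (x ✶ z) w    ≡⟨ ℤₚ.neg-distrib-+ (coeff (row c z) w) (coeff (x ✶ z) w) ⟨
    - (coeff (row c z) w +ℤ coeff (x ✶ z) w)    ≡⟨ cong -_ (coeff-++ (row c z) (x ✶ z) w) ⟨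
    - coeff (((c , a) ∷ x) ✶ z) w                ∎
    where
    open ≡-Reasoning
    row : ℤ → Lin → Lin
    row c = concatMap (λ { (d , b) → if does (length a ℕ.≟ length b) then (c *ℤ d , ParkPair (zipPair a b)) ∷ [] else [] })

    coeff-row-neg : ∀ z → coeff (row (- c) z) w ≡ - coeff (row c z) w
    coeff-row-neg [] = refl
    coeff-row-neg ((d , b) ∷ z) with does (length a ℕ.≟ length b)
    ... | false = coeff-row-neg z
    ... | true with does (ParkPair (zipPair a b) ≟W w)
    ...   | true = trans (cong₂ _+ℤ_ (sym (ℤₚ.neg-distribˡ-* c d)) (coeff-row-neg z)) (sym (ℤₚ.neg-distrib-+ (c *ℤ d) _))
    ...   | false = coeff-row-neg z

count-accept : ∀ {k x} xs → x ≡ k → count k (x ∷ xs) ≡ suc (count k xs)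
count-accept {k} xs x≡k = cong length (Listₚ.filter-accept (ℕ._≟ k) {xs = xs} x≡k)

count-reject : ∀ {k x} xs → ¬ x ≡ k → count k (x ∷ xs) ≡ count k xs
count-reject {k} xs x≢k = cong length (Listₚ.filter-reject (ℕ._≟ k) {xs = xs} x≢k)

count-++ : ∀ k xs ys → count k (xs ++ ys) ≡ count k xs + count k ys
count-++ k xs ys = trans (cong length (Listₚ.filter-++ (ℕ._≟ k) xs ys)) (Listₚ.length-++ (filter (ℕ._≟ k) xs))

count-replicate-self : ∀ k e → count k (replicate e k) ≡ e
count-replicate-self k e = trans (cong length (Listₚ.filter-all (ℕ._≟ k) (Allₚ.replicate⁺ e refl))) (Listₚ.length-replicate e)

count-replicate-other : ∀ k m e → ¬ m ≡ k → count k (replicate e m) ≡ 0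
count-replicate-other k m e m≢k = cong length (Listₚ.filter-none (ℕ._≟ k) (Allₚ.replicate⁺ e m≢k))

count-below : ∀ k m w → All (m ≤_) w → k < m → count k w ≡ 0
count-below k m w m≤w k<m = cong length (Listₚ.filter-none (ℕ._≟ k) (All.map (λ m≤x x≡k → ℕₚ.<⇒≱ k<m (subst (m ≤_) x≡k m≤x)) m≤w))

fromEvFrom-≥ : ∀ k v → All (k ≤_) (fromEvFrom k v)
fromEvFrom-≥ k [] = []
fromEvFrom-≥ k (e ∷ v) = Allₚ.++⁺ (Allₚ.replicate⁺ e ℕₚ.≤-refl) (All.map (ℕₚ.≤-trans (ℕₚ.n≤1+n k)) (fromEvFrom-≥ (suc k) v))

fromEvFrom-zeros : ∀ k z v → fromEvFrom k (replicate z 0 ++ v) ≡ fromEvFrom (k + z) v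
fromEvFrom-zeros k zero v = cong (λ q → fromEvFrom q v) (sym (ℕₚ.+-identityʳ k))
fromEvFrom-zeros k (suc z) v = trans (fromEvFrom-zeros (suc k) z v) (cong (λ q → fromEvFrom q v) (sym (ℕₚ.+-suc k z)))

applyUpTo-cong : ∀ {f g : ℕ → ℕ} m → (∀ i → f i ≡ g i) → applyUpTo f m ≡ applyUpTo g m
applyUpTo-cong zero f≗g = refl
applyUpTo-cong (suc m) f≗g = cong₂ _∷_ (f≗g 0) (applyUpTo-cong m (λ i → f≗g (suc i)))

EvFrom : ℕ → ℕ → Word → List ℕ
EvFrom k m w = applyUpTo (λ i → count (k + i) w) m

EvFrom-fromEvFrom : ∀ k v → EvFrom k (length v) (fromEvFrom k v) ≡ v
EvFrom-fromEvFrom k [] = refl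
EvFrom-fromEvFrom k (e ∷ v) = cong₂ _∷_ head-count (trans (applyUpTo-cong (length v) tail-count) (EvFrom-fromEvFrom (suc k) v))
  where
  rest = fromEvFrom (suc k) v
  head-count : count (k + 0) (replicate e k ++ rest) ≡ e
  head-count rewrite ℕₚ.+-identityʳ k | count-++ k (replicate e k) rest | count-replicate-self k e
    | count-below k (suc k) rest (fromEvFrom-≥ (suc k) v) ℕₚ.≤-refl = ℕₚ.+-identityʳ e
  tail-count : ∀ i → count (k + suc i) (replicate e k ++ rest) ≡ count (suc k + i) rest
  tail-count i rewrite ℕₚ.+-suc k i | count-++ (suc (k + i)) (replicate e k) rest
    | count-replicate-other (suc (k + i)) k e (ℕₚ.m≢1+m+n k) = refl

maxL-++ : ∀ xs ys → maxL (xs ++ ys) ≡ maxL xs ⊔ maxL ys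
maxL-++ [] ys = refl
maxL-++ (x ∷ xs) ys = trans (cong (x ⊔_) (maxL-++ xs ys)) (sym (ℕₚ.⊔-assoc x _ _))

maxL-replicate : ∀ e k → maxL (replicate e k) ≤ k
maxL-replicate zero k = z≤n
maxL-replicate (suc e) k = ℕₚ.⊔-lub ℕₚ.≤-refl (maxL-replicate e k)

maxL-upperBound : ∀ π → All (_≤ maxL π) π
maxL-upperBound [] = []
maxL-upperBound (x ∷ π) = ℕₚ.m≤m⊔n x (maxL π) ∷ All.map (λ p → ℕₚ.≤-trans p (ℕₚ.m≤n⊔m x (maxL π))) (maxL-upperBound π)

data LastNonZero : List ℕ → Set where
  [_+1] : ∀ e → LastNonZero (suc e ∷ [])
  _∷_ : ∀ x {v} → LastNonZero v → LastNonZero (x ∷ v)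

LastNonZero-++ : ∀ xs {v} → LastNonZero v → LastNonZero (xs ++ v)
LastNonZero-++ [] p = p
LastNonZero-++ (x ∷ xs) p = x ∷ LastNonZero-++ xs p

maxL-fromEvFrom : ∀ k v → LastNonZero v → maxL (fromEvFrom (suc k) v) ≡ k + length v
maxL-fromEvFrom k (suc e ∷ []) [ e +1] = trans (ℕₚ.m≥n⇒m⊔n≡m bound) (ℕₚ.+-comm 1 k)
  where
  bound : maxL (replicate e (suc k) ++ []) ≤ suc k
  bound rewrite maxL-++ (replicate e (suc k)) [] = ℕₚ.⊔-lub (maxL-replicate e (suc k)) z≤n
maxL-fromEvFrom k (x ∷ v) (.x ∷ p) =
  trans (maxL-++ (replicate x (suc k)) (fromEvFrom (suc (suc k)) v))
    (trans (cong (maxL (replicate x (suc k)) ⊔_) (maxL-fromEvFrom (suc k) v p))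
      (trans (ℕₚ.m≤n⇒m⊔n≡n (ℕₚ.≤-trans (maxL-replicate x (suc k)) (ℕₚ.m≤m+n (suc k) (length v))))
        (sym (ℕₚ.+-suc k (length v)))))

Ev-fromEv : ∀ v → LastNonZero v → Ev (fromEv v) ≡ v
Ev-fromEv v p rewrite maxL-fromEvFrom 0 v p = EvFrom-fromEvFrom 1 v

sorted-split : ∀ k π → AllPairs _≤_ π → All (k ≤_) π → π ≡ replicate (count k π) k ++ filter (λ x → ¬? (x ℕ.≟ k)) π
sorted-split k [] _ _ = refl
sorted-split k (x ∷ π) (x≤π ∷ sπ) (k≤x ∷ k≤π) with x ℕ.≟ k
... | yes refl rewrite count-accept π (refl {x = x}) | Listₚ.filter-reject (λ y → ¬? (y ℕ.≟ x)) {xs = π} (λ x≢x → x≢x refl) =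
      cong (x ∷_) (sorted-split x π sπ k≤π)
... | no x≢k rewrite count-reject π x≢k | count-below k (suc k) π (All.map (ℕₚ.<-≤-trans (ℕₚ.≤∧≢⇒< k≤x (x≢k ∘ sym))) x≤π) ℕₚ.≤-refl
      | Listₚ.filter-all (λ y → ¬? (y ℕ.≟ k)) {xs = x ∷ π} (x≢k ∷ All.map (λ x≤y y≡k → ℕₚ.<-irrefl (sym y≡k) (ℕₚ.<-≤-trans (ℕₚ.≤∧≢⇒< k≤x (x≢k ∘ sym)) x≤y)) x≤π) = refl

fromEvFrom-EvFrom : ∀ m k π → AllPairs _≤_ π → All (k ≤_) π → All (_< k + m) π → fromEvFrom k (EvFrom k m π) ≡ π
fromEvFrom-EvFrom zero k [] _ _ _ = refl
fromEvFrom-EvFrom zero k (x ∷ π) _ (k≤x ∷ _) (x<k+0 ∷ _) = ⊥-elim (ℕₚ.<-irrefl refl (ℕₚ.<-≤-trans (ℕₚ.<-≤-trans x<k+0 (ℕₚ.≤-reflexive (ℕₚ.+-identityʳ k))) k≤x))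
fromEvFrom-EvFrom (suc m) k π sπ k≤π π<k+m =
  trans (cong₂ (λ c t → replicate c k ++ fromEvFrom (suc k) t) (cong (λ q → count q π) (ℕₚ.+-identityʳ k)) tail-eq)
    (trans (cong (replicate (count k π) k ++_) (fromEvFrom-EvFrom m (suc k) R sR k<R R<k+m)) (sym split))
  where
  R = filter (λ x → ¬? (x ℕ.≟ k)) π
  split = sorted-split k π sπ k≤π
  sR : AllPairs _≤_ R
  sR = AllPairsₚ.filter⁺ (λ x → ¬? (x ℕ.≟ k)) sπ
  k<R : All (suc k ≤_) R
  k<R = All.zipWith (λ { (k≤x , x≢k) → ℕₚ.≤∧≢⇒< k≤x (x≢k ∘ sym) })
          (Allₚ.filter⁺ (λ x → ¬? (x ℕ.≟ k)) k≤π , Allₚ.all-filter (λ x → ¬? (x ℕ.≟ k)) π)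
  R<k+m : All (_< suc k + m) R
  R<k+m = All.map (λ p → ℕₚ.<-≤-trans p (ℕₚ.≤-reflexive (ℕₚ.+-suc k m))) (Allₚ.filter⁺ (λ x → ¬? (x ℕ.≟ k)) π<k+m)
  tail-eq : applyUpTo (λ i → count (k + suc i) π) m ≡ EvFrom (suc k) m R
  tail-eq = applyUpTo-cong m (λ i → trans (cong (count (k + suc i)) split)
    (trans (count-++ (k + suc i) (replicate (count k π) k) R)
      (trans (cong (_+ count (k + suc i) R) (count-replicate-other (k + suc i) k (count k π) (λ e → ℕₚ.m≢1+m+n k (trans e (ℕₚ.+-suc k i)))))
        (cong (λ q → count q R) (ℕₚ.+-suc k i)))))

ParkCond⇒positive : ∀ k π → ParkCond k π → All (1 ≤_) π
ParkCond⇒positive k [] _ = []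
ParkCond⇒positive k (x ∷ π) (1≤x , _ , p) = 1≤x ∷ ParkCond⇒positive (suc k) π p

fromEv-Ev : ∀ π → IsNDPF π → fromEv (Ev π) ≡ π
fromEv-Ev π (sorted , park) =
  fromEvFrom-EvFrom (maxL π) 1 π (Linkedₚ.Linked⇒AllPairs ℕₚ.≤-trans sorted) (ParkCond⇒positive 1 π park) (All.map s≤s (maxL-upperBound π))

-- (c , z) : a nonzero entry c of an evaluation vector followed by z zeros.
Block : Set
Block = ℕ × ℕ

-- Merging two adjacent blocks is one successor step of the Catalan-ribbon order.
infixl 6 _⊕_
_⊕_ : Block → Block → Block
(c , z) ⊕ (c′ , z′) = (c + c′ , z + suc z′)

⊕-assoc : ∀ x y w → x ⊕ (y ⊕ w) ≡ (x ⊕ y) ⊕ w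
⊕-assoc (a , b) (c , d) (e , f) = cong₂ _,_ (sym (ℕₚ.+-assoc a c e)) (sym (ℕₚ.+-assoc b (suc d) (suc f)))

parts : List Block → List ℕ
parts = map proj₁

blockEv : List Block → List ℕ
blockEv [] = []
blockEv ((c , z) ∷ K) = c ∷ (replicate z 0 ++ blockEv K)

blockWord : List Block → Word
blockWord K = fromEv (blockEv K)

Positive : List Block → Set
Positive = All (λ b → 1 ≤ proj₁ b)

-- Zeros after the last block are invisible in blockWord, and absent from Ev.
trimLast : List Block → List Block
trimLast [] = []
trimLast ((c , z) ∷ []) = (c , 0) ∷ []
trimLast (b ∷ b′ ∷ K) = b ∷ trimLast (b′ ∷ K)

merges : List Block → List (List Block)
merges (x ∷ y ∷ r) = (x ⊕ y ∷ r) ∷ map (x ∷_) (merges (y ∷ r))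
merges _ = []

zeros-+-suc : ∀ z z′ (v : List ℕ) → replicate (z + suc z′) 0 ++ v ≡ replicate z 0 ++ (0 ∷ replicate z′ 0 ++ v)
zeros-+-suc zero z′ v = refl
zeros-+-suc (suc z) z′ v = cong (0 ∷_) (zeros-+-suc z z′ v)

absorb-zeros : ∀ z v → absorb (replicate z 0 ++ v) ≡ Maybe.map (λ p → (proj₁ p , replicate z 0 ++ proj₂ p)) (absorb v)
absorb-zeros zero v with absorb v
... | nothing = refl
... | just _ = refl
absorb-zeros (suc z) v rewrite absorb-zeros z v with absorb v
... | nothing = refl
... | just _ = refl

succV-zeros : ∀ z v → succV (replicate z 0 ++ v) ≡ map (replicate z 0 ++_) (succV v)
succV-zeros zero v = sym (Listₚ.map-id (succV v))
succV-zeros (suc z) v = trans (cong (map (0 ∷_)) (succV-zeros z v)) (sym (Listₚ.map-∘ (succV v)))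

succV-blockEv-∷ : ∀ b K → Positive (b ∷ K) → succV (blockEv K) ≡ map blockEv (merges K) →
                  succV (blockEv (b ∷ K)) ≡ map blockEv (merges (b ∷ K))
succV-blockEv-∷ (suc c , z) [] (s≤s z≤n ∷ []) _ rewrite absorb-zeros z [] | succV-zeros z [] = refl
succV-blockEv-∷ (suc c , z) ((suc c′ , z′) ∷ r) (s≤s z≤n ∷ s≤s z≤n ∷ _) ih rewrite absorb-zeros z (blockEv ((suc c′ , z′) ∷ r)) =
  cong₂ _∷_ (cong (suc (c + suc c′) ∷_) (sym (zeros-+-suc z z′ (blockEv r))))
    (begin
      map (suc c ∷_) (succV (replicate z 0 ++ blockEv ((suc c′ , z′) ∷ r)))  ≡⟨ cong (map (suc c ∷_)) (succV-zeros z _) ⟩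
      map (suc c ∷_) (map (replicate z 0 ++_) (succV (blockEv ((suc c′ , z′) ∷ r))))
        ≡⟨ cong (λ q → map (suc c ∷_) (map (replicate z 0 ++_) q)) ih ⟩
      map (suc c ∷_) (map (replicate z 0 ++_) (map blockEv M))  ≡⟨ Listₚ.map-∘ (map blockEv M) ⟨
      map ((suc c ∷_) ∘ (replicate z 0 ++_)) (map blockEv M)    ≡⟨ Listₚ.map-∘ M ⟨
      map (λ K → blockEv ((suc c , z) ∷ K)) M                   ≡⟨ Listₚ.map-∘ M ⟩
      map blockEv (map ((suc c , z) ∷_) M)                      ∎)
  where
  open ≡-Reasoning
  M = merges ((suc c′ , z′) ∷ r)

succV-blockEv : ∀ K → Positive K → succV (blockEv K) ≡ map blockEv (merges K)
succV-blockEv [] _ = refl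
succV-blockEv (b ∷ K) (pb ∷ pK) = succV-blockEv-∷ b K (pb ∷ pK) (succV-blockEv K pK)

trimLast-∷-trimLast : ∀ b K → trimLast (b ∷ trimLast K) ≡ trimLast (b ∷ K)
trimLast-∷-trimLast b [] = refl
trimLast-∷-trimLast b (_ ∷ []) = refl
trimLast-∷-trimLast b (w ∷ w′ ∷ K) = cong (b ∷_) (trimLast-∷-trimLast w (w′ ∷ K))

parts-trimLast : ∀ K → parts (trimLast K) ≡ parts K
parts-trimLast [] = refl
parts-trimLast (_ ∷ []) = refl
parts-trimLast (b ∷ b′ ∷ K) = cong (proj₁ b ∷_) (parts-trimLast (b′ ∷ K))

merges-trimLast : ∀ K → map trimLast (merges (trimLast K)) ≡ map trimLast (merges K)
merges-trimLast [] = refl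
merges-trimLast (_ ∷ []) = refl
merges-trimLast (x ∷ y ∷ []) = refl
merges-trimLast (x ∷ y ∷ w ∷ r) = cong₂ _∷_ (trimLast-∷-trimLast (x ⊕ y) (w ∷ r)) (begin
  map trimLast (map (x ∷_) (merges (trimLast L)))                 ≡⟨ Listₚ.map-∘ (merges (trimLast L)) ⟨
  map (trimLast ∘ (x ∷_)) (merges (trimLast L))                   ≡⟨ Listₚ.map-cong (λ M → sym (trimLast-∷-trimLast x M)) _ ⟩
  map (trimLast ∘ (x ∷_) ∘ trimLast) (merges (trimLast L))        ≡⟨ Listₚ.map-∘ (merges (trimLast L)) ⟩
  map (trimLast ∘ (x ∷_)) (map trimLast (merges (trimLast L)))    ≡⟨ cong (map (trimLast ∘ (x ∷_))) (merges-trimLast (y ∷ w ∷ r)) ⟩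
  map (trimLast ∘ (x ∷_)) (map trimLast (merges L))               ≡⟨ Listₚ.map-∘ (merges L) ⟨
  map (trimLast ∘ (x ∷_) ∘ trimLast) (merges L)                   ≡⟨ Listₚ.map-cong (λ M → trimLast-∷-trimLast x M) _ ⟩
  map (trimLast ∘ (x ∷_)) (merges L)                              ≡⟨ Listₚ.map-∘ (merges L) ⟩
  map trimLast (map (x ∷_) (merges L))                            ∎)
  where
  open ≡-Reasoning
  L = y ∷ w ∷ r

fromEvFrom-blockEv-trimLast : ∀ k K → fromEvFrom k (blockEv (trimLast K)) ≡ fromEvFrom k (blockEv K)
fromEvFrom-blockEv-trimLast k [] = refl
fromEvFrom-blockEv-trimLast k ((c , z) ∷ []) = cong (replicate c k ++_) (sym (fromEvFrom-zeros (suc k) z []))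
fromEvFrom-blockEv-trimLast k ((c , z) ∷ b ∷ K) = cong (replicate c k ++_) (begin
  fromEvFrom (suc k) (replicate z 0 ++ blockEv (trimLast (b ∷ K)))  ≡⟨ fromEvFrom-zeros (suc k) z _ ⟩
  fromEvFrom (suc k + z) (blockEv (trimLast (b ∷ K)))               ≡⟨ fromEvFrom-blockEv-trimLast (suc k + z) (b ∷ K) ⟩
  fromEvFrom (suc k + z) (blockEv (b ∷ K))                          ≡⟨ fromEvFrom-zeros (suc k) z _ ⟨
  fromEvFrom (suc k) (replicate z 0 ++ blockEv (b ∷ K))             ∎)
  where open ≡-Reasoning

blockWord-trimLast : ∀ K → blockWord (trimLast K) ≡ blockWord K
blockWord-trimLast = fromEvFrom-blockEv-trimLast 1

LastNonZero-blockEv-trimLast : ∀ b K → Positive (b ∷ K) → LastNonZero (blockEv (trimLast (b ∷ K)))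
LastNonZero-blockEv-trimLast (suc c , z) [] (s≤s z≤n ∷ _) = [ c +1]
LastNonZero-blockEv-trimLast (c , z) (b ∷ K) (_ ∷ pos) = c ∷ LastNonZero-++ (replicate z 0) (LastNonZero-blockEv-trimLast b K pos)

Ev-blockWord : ∀ K → Positive K → Ev (blockWord K) ≡ blockEv (trimLast K)
Ev-blockWord [] _ = refl
Ev-blockWord (b ∷ K) pos = begin
  Ev (blockWord (b ∷ K))                    ≡⟨ cong Ev (blockWord-trimLast (b ∷ K)) ⟨
  Ev (fromEv (blockEv (trimLast (b ∷ K))))  ≡⟨ Ev-fromEv _ (LastNonZero-blockEv-trimLast b K pos) ⟩
  blockEv (trimLast (b ∷ K))                ∎
  where open ≡-Reasoning

Positive-trimLast : ∀ K → Positive K → Positive (trimLast K)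
Positive-trimLast [] _ = []
Positive-trimLast (_ ∷ []) (p ∷ []) = p ∷ []
Positive-trimLast (b ∷ b′ ∷ K) (p ∷ pos) = p ∷ Positive-trimLast (b′ ∷ K) pos

succW-blockWord : ∀ K → Positive K → succW (blockWord K) ≡ map blockWord (merges K)
succW-blockWord K pos = begin
  map fromEv (succV (Ev (blockWord K)))                   ≡⟨ cong (map fromEv ∘ succV) (Ev-blockWord K pos) ⟩
  map fromEv (succV (blockEv (trimLast K)))               ≡⟨ cong (map fromEv) (succV-blockEv (trimLast K) (Positive-trimLast K pos)) ⟩
  map fromEv (map blockEv (merges (trimLast K)))          ≡⟨ Listₚ.map-∘ (merges (trimLast K)) ⟨
  map blockWord (merges (trimLast K))                     ≡⟨ Listₚ.map-cong blockWord-trimLast _ ⟨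
  map (blockWord ∘ trimLast) (merges (trimLast K))        ≡⟨ Listₚ.map-∘ (merges (trimLast K)) ⟩
  map blockWord (map trimLast (merges (trimLast K)))      ≡⟨ cong (map blockWord) (merges-trimLast K) ⟩
  map blockWord (map trimLast (merges K))                 ≡⟨ Listₚ.map-∘ (merges K) ⟨
  map (blockWord ∘ trimLast) (merges K)                   ≡⟨ Listₚ.map-cong blockWord-trimLast _ ⟩
  map blockWord (merges K)                                ∎
  where open ≡-Reasoning

nonzeros-zeros : ∀ z v → nonzeros (replicate z 0 ++ v) ≡ nonzeros v
nonzeros-zeros zero v = refl
nonzeros-zeros (suc z) v = nonzeros-zeros z v

nonzeros-blockEv : ∀ K → Positive K → nonzeros (blockEv K) ≡ parts K
nonzeros-blockEv [] _ = refl
nonzeros-blockEv ((suc c , z) ∷ K) (s≤s z≤n ∷ pos) = cong (suc c ∷_) (trans (nonzeros-zeros z (blockEv K)) (nonzeros-blockEv K pos))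

composition : Word → List ℕ
composition π = nonzeros (Ev π)

composition-blockWord : ∀ K → Positive K → composition (blockWord K) ≡ parts K
composition-blockWord K pos = begin
  nonzeros (Ev (blockWord K))      ≡⟨ cong nonzeros (Ev-blockWord K pos) ⟩
  nonzeros (blockEv (trimLast K))  ≡⟨ nonzeros-blockEv (trimLast K) (Positive-trimLast K pos) ⟩
  parts (trimLast K)               ≡⟨ parts-trimLast K ⟩
  parts K                          ∎
  where open ≡-Reasoning

splitBlocks : List ℕ → ℕ × List Block
splitBlocks [] = 0 , []
splitBlocks (zero ∷ v) = suc (proj₁ (splitBlocks v)) , proj₂ (splitBlocks v)
splitBlocks (suc c ∷ v) = 0 , (suc c , proj₁ (splitBlocks v)) ∷ proj₂ (splitBlocks v)

splitBlocks-correct : ∀ v → replicate (proj₁ (splitBlocks v)) 0 ++ blockEv (proj₂ (splitBlocks v)) ≡ v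
splitBlocks-correct [] = refl
splitBlocks-correct (zero ∷ v) = cong (0 ∷_) (splitBlocks-correct v)
splitBlocks-correct (suc c ∷ v) = cong (suc c ∷_) (splitBlocks-correct v)

splitBlocks-positive : ∀ v → Positive (proj₂ (splitBlocks v))
splitBlocks-positive [] = []
splitBlocks-positive (zero ∷ v) = splitBlocks-positive v
splitBlocks-positive (suc c ∷ v) = s≤s z≤n ∷ splitBlocks-positive v

1⊔n≡suc[n∸1] : ∀ n → 1 ⊔ n ≡ suc (n ∸ 1)
1⊔n≡suc[n∸1] zero = refl
1⊔n≡suc[n∸1] (suc n) = refl

Ev-1∷ : ∀ π → Ev (1 ∷ π) ≡ suc (count 1 π) ∷ applyUpTo (λ i → count (suc (suc i)) (1 ∷ π)) (maxL π ∸ 1)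
Ev-1∷ π rewrite 1⊔n≡suc[n∸1] (maxL π) = cong (_∷ applyUpTo (λ i → count (suc (suc i)) (1 ∷ π)) (maxL π ∸ 1)) (count-accept π refl)

NDPF⇒blockWord : ∀ π → IsNDPF π → ∃ λ K → Positive K × blockWord K ≡ π
NDPF⇒blockWord [] _ = [] , [] , refl
NDPF⇒blockWord (x ∷ π) ndpf@(_ , 1≤x , x≤1 , _) with ℕₚ.≤-antisym x≤1 1≤x
... | refl = proj₂ (splitBlocks (Ev (1 ∷ π))) , splitBlocks-positive (Ev (1 ∷ π)) , (begin
  fromEv (blockEv (proj₂ (splitBlocks (Ev (1 ∷ π)))))  ≡⟨ cong (fromEv ∘ blockEv ∘ proj₂ ∘ splitBlocks) (Ev-1∷ π) ⟩
  fromEv (blockEv (proj₂ (splitBlocks (suc c ∷ v))))    ≡⟨ cong fromEv (splitBlocks-correct (suc c ∷ v)) ⟩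
  fromEv (suc c ∷ v)                                    ≡⟨ cong fromEv (Ev-1∷ π) ⟨
  fromEv (Ev (1 ∷ π))                                   ≡⟨ fromEv-Ev (1 ∷ π) ndpf ⟩
  1 ∷ π                                                 ∎)
  where
  open ≡-Reasoning
  c = count 1 π
  v = applyUpTo (λ i → count (suc (suc i)) (1 ∷ π)) (maxL π ∸ 1)

data CoarseningFrom : Block → List Block → List Block → Set where
  end : ∀ {x} → CoarseningFrom x [] (x ∷ [])
  cut : ∀ {x y r M} → CoarseningFrom y r M → CoarseningFrom x (y ∷ r) (x ∷ M)
  merge : ∀ {x y r M} → CoarseningFrom (x ⊕ y) r M → CoarseningFrom x (y ∷ r) M

Coarsening : List Block → List Block → Set
Coarsening [] M = M ≡ []
Coarsening (x ∷ r) M = CoarseningFrom x r M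

CoarseningFrom-refl : ∀ x r → CoarseningFrom x r (x ∷ r)
CoarseningFrom-refl x [] = end
CoarseningFrom-refl x (y ∷ r) = cut (CoarseningFrom-refl y r)

Coarsening-refl : ∀ K → Coarsening K K
Coarsening-refl [] = refl
Coarsening-refl (x ∷ r) = CoarseningFrom-refl x r

∈-merges⇒∷ : ∀ {K M} → M ∈ merges K → ∃ λ m → ∃ λ ms → M ≡ m ∷ ms
∈-merges⇒∷ {x ∷ y ∷ r} (here refl) = _ , _ , refl
∈-merges⇒∷ {x ∷ y ∷ r} (there p) with ∈-map⁻ (x ∷_) p
... | _ , _ , refl = _ , _ , refl

length-∈-merges : ∀ {K M} → M ∈ merges K → suc (length M) ≡ length K
length-∈-merges {x ∷ y ∷ r} (here refl) = refl
length-∈-merges {x ∷ y ∷ r} (there p) with ∈-map⁻ (x ∷_) p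
... | _ , m , refl = cong suc (length-∈-merges {y ∷ r} m)

CoarseningFrom-merges : ∀ x r {M N} → M ∈ merges r → CoarseningFrom x M N → CoarseningFrom x r N
CoarseningFrom-merges x (y ∷ z ∷ s) (here refl) (cut p) = cut (merge p)
CoarseningFrom-merges x (y ∷ z ∷ s) {N = N} (here refl) (merge p) = merge (merge (subst (λ q → CoarseningFrom q s N) (⊕-assoc x y z) p))
CoarseningFrom-merges x (y ∷ z ∷ s) (there m) q with ∈-map⁻ (y ∷_) m
CoarseningFrom-merges x (y ∷ z ∷ s) (there m) (cut p) | _ , m′ , refl = cut (CoarseningFrom-merges y (z ∷ s) m′ p)
CoarseningFrom-merges x (y ∷ z ∷ s) (there m) (merge p) | _ , m′ , refl = merge (CoarseningFrom-merges (x ⊕ y) (z ∷ s) m′ p)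

Coarsening-merges : ∀ K {M N} → M ∈ merges K → Coarsening M N → Coarsening K N
Coarsening-merges (x ∷ y ∷ r) (here refl) p = merge p
Coarsening-merges (x ∷ y ∷ r) (there m) p with ∈-map⁻ (x ∷_) m
... | _ , m′ , refl = CoarseningFrom-merges x (y ∷ r) m′ p

CoarseningFrom-refl-or-merges : ∀ x r {N} → CoarseningFrom x r N → N ≡ x ∷ r ⊎ (∃ λ M → M ∈ merges (x ∷ r) × Coarsening M N)
CoarseningFrom-refl-or-merges x [] end = inj₁ refl
CoarseningFrom-refl-or-merges x (y ∷ r) (cut p) with CoarseningFrom-refl-or-merges y r p
... | inj₁ refl = inj₁ refl
... | inj₂ (M , m , c) with ∈-merges⇒∷ m
...   | _ , _ , refl = inj₂ (x ∷ M , there (∈-map⁺ (x ∷_) m) , cut c)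
CoarseningFrom-refl-or-merges x (y ∷ r) (merge p) = inj₂ (x ⊕ y ∷ r , here refl , p)

length-CoarseningFrom : ∀ {x r N} → CoarseningFrom x r N → length N ≤ suc (length r)
length-CoarseningFrom end = ℕₚ.≤-refl
length-CoarseningFrom (cut p) = s≤s (length-CoarseningFrom p)
length-CoarseningFrom (merge p) = ℕₚ.m≤n⇒m≤1+n (length-CoarseningFrom p)

length-Coarsening : ∀ K {N} → Coarsening K N → length N ≤ length K
length-Coarsening [] refl = z≤n
length-Coarsening (x ∷ r) p = length-CoarseningFrom p

CoarseningFrom⇒∷ : ∀ {x r N} → CoarseningFrom x r N → ∃ λ m → ∃ λ ms → N ≡ m ∷ ms
CoarseningFrom⇒∷ end = _ , _ , refl
CoarseningFrom⇒∷ (cut _) = _ , _ , refl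
CoarseningFrom⇒∷ (merge p) = CoarseningFrom⇒∷ p

Positive-CoarseningFrom : ∀ {x r N} → 1 ≤ proj₁ x → Positive r → CoarseningFrom x r N → Positive N
Positive-CoarseningFrom px [] end = px ∷ []
Positive-CoarseningFrom px (py ∷ pr) (cut p) = px ∷ Positive-CoarseningFrom py pr p
Positive-CoarseningFrom {x} px (py ∷ pr) (merge p) = Positive-CoarseningFrom (ℕₚ.≤-trans px (ℕₚ.m≤m+n (proj₁ x) _)) pr p

Positive-Coarsening : ∀ K {N} → Positive K → Coarsening K N → Positive N
Positive-Coarsening [] _ refl = []
Positive-Coarsening (x ∷ r) (px ∷ pr) p = Positive-CoarseningFrom px pr p

Coarsening-sameLength⇒≡ : ∀ K {N} → Coarsening K N → length N ≡ length K → N ≡ K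
Coarsening-sameLength⇒≡ [] refl _ = refl
Coarsening-sameLength⇒≡ (x ∷ r) {N} p eq with CoarseningFrom-refl-or-merges x r p
... | inj₁ N≡K = N≡K
... | inj₂ (M , m , c) = ⊥-elim (ℕₚ.<⇒≱ shorter (ℕₚ.≤-reflexive (sym eq)))
  where
  shorter : length N < length (x ∷ r)
  shorter = ℕₚ.≤-trans (s≤s (length-Coarsening M c)) (ℕₚ.≤-reflexive (length-∈-merges {x ∷ r} m))

blockCoarseningsFrom : Block → List Block → List (List Block)
blockCoarseningsFrom x [] = (x ∷ []) ∷ []
blockCoarseningsFrom x (y ∷ r) = map (x ∷_) (blockCoarseningsFrom y r) ++ blockCoarseningsFrom (x ⊕ y) r

blockCoarsenings : List Block → List (List Block)
blockCoarsenings [] = [] ∷ []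
blockCoarsenings (x ∷ r) = blockCoarseningsFrom x r

parts-blockCoarseningsFrom : ∀ x r → map parts (blockCoarseningsFrom x r) ≡ coarseFrom (proj₁ x) (parts r)
parts-blockCoarseningsFrom x [] = refl
parts-blockCoarseningsFrom x (y ∷ r) = begin
  map parts (map (x ∷_) (blockCoarseningsFrom y r) ++ blockCoarseningsFrom (x ⊕ y) r)
    ≡⟨ Listₚ.map-++ parts (map (x ∷_) (blockCoarseningsFrom y r)) _ ⟩
  map parts (map (x ∷_) (blockCoarseningsFrom y r)) ++ map parts (blockCoarseningsFrom (x ⊕ y) r)
    ≡⟨ cong₂ _++_ (trans (sym (Listₚ.map-∘ _)) (Listₚ.map-∘ _)) (parts-blockCoarseningsFrom (x ⊕ y) r) ⟩
  map (proj₁ x ∷_) (map parts (blockCoarseningsFrom y r)) ++ coarseFrom (proj₁ x + proj₁ y) (parts r)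
    ≡⟨ cong (λ q → map (proj₁ x ∷_) q ++ coarseFrom (proj₁ x + proj₁ y) (parts r)) (parts-blockCoarseningsFrom y r) ⟩
  coarseFrom (proj₁ x) (parts (y ∷ r))
    ∎
  where open ≡-Reasoning

parts-blockCoarsenings : ∀ K → map parts (blockCoarsenings K) ≡ coarsenings (parts K)
parts-blockCoarsenings [] = refl
parts-blockCoarsenings (x ∷ r) = parts-blockCoarseningsFrom x r

CoarseningFrom⇒∈ : ∀ {x r N} → CoarseningFrom x r N → N ∈ blockCoarseningsFrom x r
CoarseningFrom⇒∈ end = here refl
CoarseningFrom⇒∈ {x} {y ∷ r} (cut p) = ∈-++⁺ˡ (∈-map⁺ (x ∷_) (CoarseningFrom⇒∈ p))
CoarseningFrom⇒∈ {x} {y ∷ r} (merge p) = ∈-++⁺ʳ (map (x ∷_) (blockCoarseningsFrom y r)) (CoarseningFrom⇒∈ p)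

∈⇒CoarseningFrom : ∀ x r {N} → N ∈ blockCoarseningsFrom x r → CoarseningFrom x r N
∈⇒CoarseningFrom x [] (here refl) = end
∈⇒CoarseningFrom x (y ∷ r) m with ∈-++⁻ (map (x ∷_) (blockCoarseningsFrom y r)) m
... | inj₂ m′ = merge (∈⇒CoarseningFrom (x ⊕ y) r m′)
... | inj₁ m′ with ∈-map⁻ (x ∷_) m′
...   | _ , m″ , refl = cut (∈⇒CoarseningFrom y r m″)

Coarsening⇒∈ : ∀ K {N} → Coarsening K N → N ∈ blockCoarsenings K
Coarsening⇒∈ [] refl = here refl
Coarsening⇒∈ (x ∷ r) p = CoarseningFrom⇒∈ p

∈⇒Coarsening : ∀ K {N} → N ∈ blockCoarsenings K → Coarsening K N
∈⇒Coarsening [] (here refl) = refl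
∈⇒Coarsening (x ∷ r) m = ∈⇒CoarseningFrom x r m

Positive-∈-merges : ∀ K {M} → Positive K → M ∈ merges K → Positive M
Positive-∈-merges K {M} pos m = Positive-Coarsening K pos (Coarsening-merges K m (Coarsening-refl M))

∈-reach-succW⁻ : ∀ f K {u} → Positive K → u ∈ concatMap (reach f) (succW (blockWord K)) →
                 ∃ λ M → M ∈ merges K × u ∈ reach f (blockWord M)
∈-reach-succW⁻ f K pos m rewrite succW-blockWord K pos with find (Anyₚ.map⁻ (∈-concatMap⁻ (reach f) {xs = map blockWord (merges K)} m))
... | M , M∈ , u∈ = M , M∈ , u∈

∈-reach-succW⁺ : ∀ f K {u M} → Positive K → M ∈ merges K → u ∈ reach f (blockWord M) → u ∈ concatMap (reach f) (succW (blockWord K))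
∈-reach-succW⁺ f K pos M∈ u∈ rewrite succW-blockWord K pos =
  ∈-concatMap⁺ (reach f) {xs = map blockWord (merges K)} (Anyₚ.map⁺ (lose M∈ u∈))

∈-reach-self : ∀ f π → π ∈ reach f π
∈-reach-self zero π = here refl
∈-reach-self (suc f) π = here refl

∈-reach⇒Coarsening : ∀ f K {u} → Positive K → u ∈ reach f (blockWord K) → ∃ λ N → Coarsening K N × u ≡ blockWord N
∈-reach⇒Coarsening zero K pos (here refl) = K , Coarsening-refl K , refl
∈-reach⇒Coarsening (suc f) K pos (here refl) = K , Coarsening-refl K , refl
∈-reach⇒Coarsening (suc f) K pos (there m) with ∈-reach-succW⁻ f K pos m
... | M , M∈ , u∈ with ∈-reach⇒Coarsening f M (Positive-∈-merges K pos M∈) u∈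
...   | N , c , refl = N , Coarsening-merges K M∈ c , refl

Coarsening⇒∈-reach : ∀ f K N → Positive K → Coarsening K N → length K ≤ f + length N → blockWord N ∈ reach f (blockWord K)
Coarsening⇒∈-reach f [] N pos refl le = ∈-reach-self f _
Coarsening⇒∈-reach f (x ∷ r) N pos c le with CoarseningFrom-refl-or-merges x r c
... | inj₁ refl = ∈-reach-self f _
Coarsening⇒∈-reach zero (x ∷ r) N pos c le | inj₂ (M , M∈ , cM) =
  ⊥-elim (ℕₚ.<⇒≱ (ℕₚ.≤-trans (s≤s (length-Coarsening M cM)) (ℕₚ.≤-reflexive (length-∈-merges {x ∷ r} M∈))) le)
Coarsening⇒∈-reach (suc f) (x ∷ r) N pos c le | inj₂ (M , M∈ , cM) =
  there (∈-reach-succW⁺ f (x ∷ r) pos M∈ (Coarsening⇒∈-reach f M N (Positive-∈-merges (x ∷ r) pos M∈) cM le′))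
  where
  le′ : length M ≤ f + length N
  le′ = ℕₚ.≤-pred (ℕₚ.≤-trans (ℕₚ.≤-reflexive (length-∈-merges {x ∷ r} M∈)) le)

∈-strictUp⇒Coarsening : ∀ f K {u} → Positive K → u ∈ strictUp f (blockWord K) →
                        ∃ λ N → Coarsening K N × length N < length K × u ≡ blockWord N
∈-strictUp⇒Coarsening f K pos m with ∈-filter⁻ (λ u → ¬? (u ≟W blockWord K)) {xs = deduplicate _≟W_ (concatMap (reach f) (succW (blockWord K)))} m
... | m′ , _ with ∈-reach-succW⁻ f K pos (∈-deduplicate⁻ _≟W_ (concatMap (reach f) (succW (blockWord K))) m′)
...   | M , M∈ , u∈ with ∈-reach⇒Coarsening f M (Positive-∈-merges K pos M∈) u∈
...     | N , c , refl = N , Coarsening-merges K M∈ c , ℕₚ.≤-trans (s≤s (length-Coarsening M c)) (ℕₚ.≤-reflexive (length-∈-merges {K} M∈)) , refl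

Coarsening⇒∈-strictUp : ∀ f K N → Positive K → Coarsening K N → length N < length K → length K ≤ suc (f + length N) →
                        blockWord N ∈ strictUp f (blockWord K)
Coarsening⇒∈-strictUp f [] N pos c () le
Coarsening⇒∈-strictUp f (x ∷ r) N pos c shorter le with CoarseningFrom-refl-or-merges x r c
... | inj₁ refl = ⊥-elim (ℕₚ.<-irrefl refl shorter)
... | inj₂ (M , M∈ , cM) =
  ∈-filter⁺ (λ u → ¬? (u ≟W blockWord (x ∷ r)))
    (∈-deduplicate⁺ _≟W_ (∈-reach-succW⁺ f (x ∷ r) pos M∈ (Coarsening⇒∈-reach f M N (Positive-∈-merges (x ∷ r) pos M∈) cM le′)))
    distinct
  where
  le′ : length M ≤ f + length N
  le′ = ℕₚ.≤-pred (ℕₚ.≤-trans (ℕₚ.≤-reflexive (length-∈-merges {x ∷ r} M∈)) le)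
  same-parts : blockWord N ≡ blockWord (x ∷ r) → parts N ≡ parts (x ∷ r)
  same-parts e = trans (sym (composition-blockWord N (Positive-Coarsening (x ∷ r) pos c)))
                   (trans (cong composition e) (composition-blockWord (x ∷ r) pos))
  distinct : ¬ blockWord N ≡ blockWord (x ∷ r)
  distinct e = ℕₚ.<-irrefl (trans (sym (Listₚ.length-map proj₁ N)) (trans (cong length (same-parts e)) (Listₚ.length-map proj₁ (x ∷ r)))) shorter

CoarseningFrom-head-≥ : ∀ {x r N} → Positive r → CoarseningFrom x r N → ∃ λ m → ∃ λ ms → N ≡ m ∷ ms × proj₁ x ≤ proj₁ m
CoarseningFrom-head-≥ _ end = _ , _ , refl , ℕₚ.≤-refl
CoarseningFrom-head-≥ _ (cut p) = _ , _ , refl , ℕₚ.≤-refl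
CoarseningFrom-head-≥ {x} (_ ∷ pr) (merge p) with CoarseningFrom-head-≥ pr p
... | m , ms , e , le = m , ms , e , ℕₚ.≤-trans (ℕₚ.m≤m+n (proj₁ x) _) le

parts-cut≢parts-merge : ∀ {x y r N₁ N₂} → Positive (y ∷ r) → CoarseningFrom y r N₁ → CoarseningFrom (x ⊕ y) r N₂ →
                        ¬ parts (x ∷ N₁) ≡ parts N₂
parts-cut≢parts-merge {x} (py ∷ pr) p₁ p₂ e with CoarseningFrom-head-≥ pr p₂
... | m , ms , refl , le = ℕₚ.<-irrefl refl (ℕₚ.<-≤-trans (ℕₚ.m<m+n (proj₁ x) py) (ℕₚ.≤-trans le (ℕₚ.≤-reflexive (sym (Listₚ.∷-injectiveˡ e)))))

parts-CoarseningFrom-injective : ∀ {x r N₁ N₂} → Positive r → CoarseningFrom x r N₁ → CoarseningFrom x r N₂ →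
                                 parts N₁ ≡ parts N₂ → N₁ ≡ N₂
parts-CoarseningFrom-injective _ end end e = refl
parts-CoarseningFrom-injective (_ ∷ pr) (cut p₁) (cut p₂) e = cong (_ ∷_) (parts-CoarseningFrom-injective pr p₁ p₂ (Listₚ.∷-injectiveʳ e))
parts-CoarseningFrom-injective (_ ∷ pr) (merge p₁) (merge p₂) e = parts-CoarseningFrom-injective pr p₁ p₂ e
parts-CoarseningFrom-injective pr (cut p₁) (merge p₂) e = ⊥-elim (parts-cut≢parts-merge pr p₁ p₂ e)
parts-CoarseningFrom-injective pr (merge p₁) (cut p₂) e = ⊥-elim (parts-cut≢parts-merge pr p₂ p₁ (sym e))

parts-Coarsening-injective : ∀ K {N₁ N₂} → Positive K → Coarsening K N₁ → Coarsening K N₂ → parts N₁ ≡ parts N₂ → N₁ ≡ N₂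
parts-Coarsening-injective [] _ refl refl _ = refl
parts-Coarsening-injective (x ∷ r) (_ ∷ pr) c₁ c₂ e = parts-CoarseningFrom-injective pr c₁ c₂ e

coarseFrom-head-≥ : ∀ z r {J} → J ∈ coarseFrom z r → ∃ λ t → ∃ λ ts → J ≡ t ∷ ts × z ≤ t
coarseFrom-head-≥ z [] (here refl) = z , [] , refl , ℕₚ.≤-refl
coarseFrom-head-≥ z (y ∷ r) m with ∈-++⁻ (map (z ∷_) (coarseFrom y r)) m
... | inj₁ m₁ with ∈-map⁻ (z ∷_) m₁
...   | J , _ , refl = z , J , refl , ℕₚ.≤-refl
coarseFrom-head-≥ z (y ∷ r) m | inj₂ m₂ with coarseFrom-head-≥ (z + y) r m₂
... | t , ts , e , le = t , ts , e , ℕₚ.≤-trans (ℕₚ.m≤m+n z y) le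

coarseFrom-unique : ∀ x r → All (1 ≤_) r → Unique (coarseFrom x r)
coarseFrom-unique x [] _ = [] ∷ []
coarseFrom-unique x (y ∷ r) (py ∷ pr) = Uniqueₚ.++⁺ (Uniqueₚ.map⁺ Listₚ.∷-injectiveʳ (coarseFrom-unique y r pr)) (coarseFrom-unique (x + y) r pr) disjoint
  where
  disjoint : ∀ {v} → ¬ (v ∈ map (x ∷_) (coarseFrom y r) × v ∈ coarseFrom (x + y) r)
  disjoint (m₁ , m₂) with ∈-map⁻ (x ∷_) m₁ | coarseFrom-head-≥ (x + y) r m₂
  ... | _ , _ , refl | t , ts , e , le = ℕₚ.<-irrefl refl (ℕₚ.<-≤-trans (ℕₚ.m<m+n x py) (ℕₚ.≤-trans le (ℕₚ.≤-reflexive (sym (Listₚ.∷-injectiveˡ e)))))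

coarsenings-unique : ∀ I → All (1 ≤_) I → Unique (coarsenings I)
coarsenings-unique [] _ = [] ∷ []
coarsenings-unique (x ∷ r) (_ ∷ pr) = coarseFrom-unique x r pr

strictCoarse-unique : ∀ I → All (1 ≤_) I → Unique (strictCoarse I)
strictCoarse-unique I pos = Uniqueₚ.filter⁺ (λ K → ¬? (K ≟W I)) (coarsenings-unique I pos)

Positive⇒parts-positive : ∀ K → Positive K → All (1 ≤_) (parts K)
Positive⇒parts-positive K pos = Allₚ.map⁺ pos

∈-strictCoarse⇒Coarsening : ∀ K {J} → J ∈ strictCoarse (parts K) → ∃ λ N → Coarsening K N × length N < length K × J ≡ parts N
∈-strictCoarse⇒Coarsening K {J} m with ∈-filter⁻ (λ K′ → ¬? (K′ ≟W parts K)) {xs = coarsenings (parts K)} m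
... | m′ , J≢K with ∈-map⁻ parts (subst (J ∈_) (sym (parts-blockCoarsenings K)) m′)
...   | N , N∈ , refl = N , c , ℕₚ.≤∧≢⇒< (length-Coarsening K c) (λ e → J≢K (cong parts (Coarsening-sameLength⇒≡ K c e))) , refl
  where c = ∈⇒Coarsening K N∈

Coarsening⇒∈-strictCoarse : ∀ K {N} → Coarsening K N → length N < length K → parts N ∈ strictCoarse (parts K)
Coarsening⇒∈-strictCoarse K {N} c shorter = ∈-filter⁺ (λ K′ → ¬? (K′ ≟W parts K))
  (subst (parts N ∈_) (parts-blockCoarsenings K) (∈-map⁺ parts (Coarsening⇒∈ K c))) distinct
  where
  distinct : ¬ parts N ≡ parts K
  distinct e = ℕₚ.<-irrefl (trans (sym (Listₚ.length-map proj₁ N)) (trans (cong length e) (Listₚ.length-map proj₁ K))) shorter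

map-unique-locally-injective : ∀ {A B : Set} (f : A → B) {xs : List A} → Unique xs →
                               (∀ {a b} → a ∈ xs → b ∈ xs → f a ≡ f b → a ≡ b) → Unique (map f xs)
map-unique-locally-injective f [] inj = []
map-unique-locally-injective f {x ∷ xs} (x∉xs ∷ uxs) inj =
  Allₚ.map⁺ (tabulate (λ y∈ fx≡fy → All.lookup x∉xs y∈ (inj (here refl) (there y∈) fx≡fy))) ∷
  map-unique-locally-injective f uxs (λ a b → inj (there a) (there b))

sumℤ-bijection : ∀ {A B : Set} (U : List A) (S : List B) (g : A → B) (h : A → ℤ) (k : B → ℤ) →
                 Unique U → Unique S → (∀ {u} → u ∈ U → h u ≡ k (g u)) → (∀ {u} → u ∈ U → g u ∈ S) →
                 (∀ {s} → s ∈ S → ∃ λ u → u ∈ U × g u ≡ s) → (∀ {a b} → a ∈ U → b ∈ U → g a ≡ g b → a ≡ b) →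
                 sumℤ (map h U) ≡ sumℤ (map k S)
sumℤ-bijection U S g h k uU uS h≡k∘g g-into g-onto g-inj = begin
  sumℤ (map h U)          ≡⟨ sumℤ-map-cong U h≡k∘g ⟩
  sumℤ (map (k ∘ g) U)    ≡⟨ cong sumℤ (Listₚ.map-∘ U) ⟩
  sumℤ (map k (map g U))  ≡⟨ sumℤ-↭ (↭ₚ.map⁺ k gU↭S) ⟩
  sumℤ (map k S)          ∎
  where
  open ≡-Reasoning
  into : ∀ {s} → s ∈ map g U → s ∈ S
  into m with ∈-map⁻ g m
  ... | u , u∈ , refl = g-into u∈
  onto : ∀ {s} → s ∈ S → s ∈ map g U
  onto m with g-onto m
  ... | u , u∈ , refl = ∈-map⁺ g u∈
  gU↭S : map g U ↭ S
  gU↭S = ∼bag⇒↭ (unique∧set⇒bag (map-unique-locally-injective g uU g-inj) uS (mk⇔ into onto))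

coeff-j-S : ∀ I w → coeff (j ((1ℤ , I) ∷ [])) w ≡ coeff (jS I) w
coeff-j-S I w = begin
  coeff (scale1 (jS I) ++ []) w  ≡⟨ coeff-++ (scale1 (jS I)) [] w ⟩
  coeff (scale1 (jS I)) w +ℤ 0ℤ  ≡⟨ ℤₚ.+-identityʳ _ ⟩
  coeff (scale1 (jS I)) w        ≡⟨ cong (λ q → coeff q w) (trans (Listₚ.map-cong (λ { (d , a) → cong (_, a) (ℤₚ.*-identityˡ d) }) (jS I)) (Listₚ.map-id (jS I))) ⟩
  coeff (jS I) w                 ∎
  where
  open ≡-Reasoning
  scale1 : Lin → Lin
  scale1 = map (λ { (d , w) → (1ℤ *ℤ d , w) })

coeff-j-RSf-suc : ∀ g I w → coeff (j (RSf (suc g) I)) w ≡ coeff (jS I) w +ℤ - sumℤ (map (λ J → coeff (j (RSf g J)) w) (strictCoarse I))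
coeff-j-RSf-suc g I w = trans (coeff-Φ-++ ((1ℤ , I) ∷ []) (neg (concatMap (RSf g) (strictCoarse I))) w)
  (cong₂ _+ℤ_ (coeff-j-S I w) (trans (coeff-Φ-neg (concatMap (RSf g) (strictCoarse I)) w) (cong -_ (coeff-Φ-concatMap (RSf g) (strictCoarse I) w))))
  where open IsLinear j-isLinear

no-members⇒[] : ∀ {A : Set} (xs : List A) → (∀ {x} → x ∈ xs → ⊥) → xs ≡ []
no-members⇒[] [] _ = refl
no-members⇒[] (x ∷ xs) none = ⊥-elim (none (here refl))

no-strict-Coarsening-of-short : ∀ K {N} → Coarsening K N → length N < length K → length K ≤ 1 → ⊥
no-strict-Coarsening-of-short [] c () short
no-strict-Coarsening-of-short (x ∷ r) c shorter short with CoarseningFrom⇒∷ c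
... | m , ms , refl = ℕₚ.<⇒≱ (ℕₚ.≤-trans shorter short) (s≤s z≤n)

strict-Coarsening-nonEmpty : ∀ K {N} → Coarsening K N → length N < length K → 1 ≤ length N
strict-Coarsening-nonEmpty (x ∷ r) c _ with CoarseningFrom⇒∷ c
... | _ , _ , refl = s≤s z≤n

strictUp-short : ∀ f K → Positive K → length K ≤ 1 → strictUp f (blockWord K) ≡ []
strictUp-short f K pos short = no-members⇒[] _ (λ m → let (_ , c , shorter , _) = ∈-strictUp⇒Coarsening f K pos m in no-strict-Coarsening-of-short K c shorter short)

strictCoarse-short : ∀ K → length K ≤ 1 → strictCoarse (parts K) ≡ []
strictCoarse-short K short = no-members⇒[] _ (λ m → let (_ , c , shorter , _) = ∈-strictCoarse⇒Coarsening K m in no-strict-Coarsening-of-short K c shorter short)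

coeff-j-RSf-short : ∀ g K → length K ≤ 1 → ∀ w → coeff (j (RSf g (parts K))) w ≡ coeff (jS (parts K)) w
coeff-j-RSf-short zero K short w = coeff-j-S (parts K) w
coeff-j-RSf-short (suc g) K short w rewrite coeff-j-RSf-suc g (parts K) w | strictCoarse-short K short = ℤₚ.+-identityʳ _

strictUp-unique : ∀ f π → Unique (strictUp f π)
strictUp-unique f π = Uniqueₚ.filter⁺ (λ u → ¬? (u ≟W π)) (UniqueDecₚ.deduplicate-! _≟W_ (concatMap (reach f) (succW π)))

composition-∈-strictCoarse : ∀ f K → Positive K → ∀ {u} → u ∈ strictUp f (blockWord K) → composition u ∈ strictCoarse (parts K)
composition-∈-strictCoarse f K pos m with ∈-strictUp⇒Coarsening f K pos m
... | N , c , shorter , refl =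
  subst (_∈ strictCoarse (parts K)) (sym (composition-blockWord N (Positive-Coarsening K pos c))) (Coarsening⇒∈-strictCoarse K c shorter)

strictCoarse-∈-composition : ∀ f K → Positive K → length K ≤ suc (suc f) →
                             ∀ {J} → J ∈ strictCoarse (parts K) → ∃ λ u → u ∈ strictUp f (blockWord K) × composition u ≡ J
strictCoarse-∈-composition f K pos fuel m with ∈-strictCoarse⇒Coarsening K m
... | N , c , shorter , refl = blockWord N , Coarsening⇒∈-strictUp f K N pos c shorter fuel′ , composition-blockWord N (Positive-Coarsening K pos c)
  where
  fuel′ : length K ≤ suc (f + length N)
  fuel′ = ℕₚ.≤-trans fuel (s≤s (ℕₚ.m<m+n f (strict-Coarsening-nonEmpty K c shorter)))

composition-injective-on-strictUp : ∀ f K → Positive K → ∀ {a b} → a ∈ strictUp f (blockWord K) → b ∈ strictUp f (blockWord K) →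
                                    composition a ≡ composition b → a ≡ b
composition-injective-on-strictUp f K pos ma mb e with ∈-strictUp⇒Coarsening f K pos ma | ∈-strictUp⇒Coarsening f K pos mb
... | N₁ , c₁ , _ , refl | N₂ , c₂ , _ , refl = cong blockWord (parts-Coarsening-injective K pos c₁ c₂
  (trans (sym (composition-blockWord N₁ (Positive-Coarsening K pos c₁))) (trans e (composition-blockWord N₂ (Positive-Coarsening K pos c₂)))))

-- Any fuel exceeding the number of blocks computes R_π and R_I.
module RibbonTransfer (Φ : Lin → Lin) (Φ-linear : IsLinear Φ) (Q : List Block → Set)
                      (Q-Coarsening : ∀ K N → Positive K → Q K → Coarsening K N → Q N)
                      (Φ-P : ∀ K → Positive K → Q K → ∀ w → coeff (Φ (P (blockWord K))) w ≡ coeff (jS (parts K)) w) where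

  open IsLinear Φ-linear

  coeff-Φ-Rf-suc : ∀ f π w → coeff (Φ (Rf (suc f) π)) w ≡ coeff (Φ (P π)) w +ℤ - sumℤ (map (λ u → coeff (Φ (Rf f u)) w) (strictUp f π))
  coeff-Φ-Rf-suc f π w = trans (coeff-Φ-++ (P π) (neg (concatMap (Rf f) (strictUp f π))) w)
    (cong (coeff (Φ (P π)) w +ℤ_) (trans (coeff-Φ-neg _ w) (cong -_ (coeff-Φ-concatMap (Rf f) (strictUp f π) w))))

  coeff-Φ-Rf-short : ∀ f K → Positive K → length K ≤ 1 → ∀ w → coeff (Φ (Rf f (blockWord K))) w ≡ coeff (Φ (P (blockWord K))) w
  coeff-Φ-Rf-short zero K pos short w = refl
  coeff-Φ-Rf-short (suc f) K pos short w rewrite coeff-Φ-Rf-suc f (blockWord K) w | strictUp-short f K pos short = ℤₚ.+-identityʳ _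

  Φ-Rf≈j-RSf : ∀ f g K → Positive K → Q K → length K ≤ suc f → length K ≤ suc g → ∀ w →
               coeff (Φ (Rf f (blockWord K))) w ≡ coeff (j (RSf g (parts K))) w
  Φ-Rf≈j-RSf zero g K pos q lf lg w =
    trans (coeff-Φ-Rf-short zero K pos lf w) (trans (Φ-P K pos q w) (sym (coeff-j-RSf-short g K lf w)))
  Φ-Rf≈j-RSf (suc f) zero K pos q lf lg w =
    trans (coeff-Φ-Rf-short (suc f) K pos lg w) (trans (Φ-P K pos q w) (sym (coeff-j-RSf-short zero K lg w)))
  Φ-Rf≈j-RSf (suc f) (suc g) K pos q lf lg w = begin
    coeff (Φ (Rf (suc f) (blockWord K))) w                       ≡⟨ coeff-Φ-Rf-suc f (blockWord K) w ⟩
    coeff (Φ (P (blockWord K))) w +ℤ - sumℤ (map lhs upper)       ≡⟨ cong₂ (λ a b → a +ℤ - b) (Φ-P K pos q w) sums-agree ⟩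
    coeff (jS (parts K)) w +ℤ - sumℤ (map rhs coarser)          ≡⟨ coeff-j-RSf-suc g (parts K) w ⟨
    coeff (j (RSf (suc g) (parts K))) w                          ∎
    where
    open ≡-Reasoning
    upper = strictUp f (blockWord K)
    coarser = strictCoarse (parts K)
    lhs = λ u → coeff (Φ (Rf f u)) w
    rhs = λ J → coeff (j (RSf g J)) w

    lhs≡rhs : ∀ {u} → u ∈ upper → lhs u ≡ rhs (composition u)
    lhs≡rhs m with ∈-strictUp⇒Coarsening f K pos m
    ... | N , c , shorter , refl = trans
      (Φ-Rf≈j-RSf f g N posN (Q-Coarsening K N pos q c) (ℕₚ.≤-pred (ℕₚ.≤-trans shorter lf)) (ℕₚ.≤-pred (ℕₚ.≤-trans shorter lg)) w)
      (cong rhs (sym (composition-blockWord N posN)))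
      where posN = Positive-Coarsening K pos c

    sums-agree : sumℤ (map lhs upper) ≡ sumℤ (map rhs coarser)
    sums-agree = sumℤ-bijection upper coarser composition lhs rhs (strictUp-unique f (blockWord K))
      (strictCoarse-unique (parts K) (Positive⇒parts-positive K pos)) lhs≡rhs
      (composition-∈-strictCoarse f K pos) (strictCoarse-∈-composition f K pos lf) (composition-injective-on-strictUp f K pos)

∈-insertAll⇒↭ : ∀ x ys {w} → w ∈ insertAll x ys → w ↭ x ∷ ys
∈-insertAll⇒↭ x [] (here refl) = ↭-refl
∈-insertAll⇒↭ x (y ∷ ys) (here refl) = ↭-refl
∈-insertAll⇒↭ x (y ∷ ys) (there m) with ∈-map⁻ (y ∷_) m
... | _ , m′ , refl = ↭-trans (↭-prep y (∈-insertAll⇒↭ x ys m′)) (↭-swap y x ↭-refl)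

∈-insertAll-middle : ∀ x as bs → as ++ x ∷ bs ∈ insertAll x (as ++ bs)
∈-insertAll-middle x [] [] = here refl
∈-insertAll-middle x [] (b ∷ bs) = here refl
∈-insertAll-middle x (a ∷ as) bs = there (∈-map⁺ (a ∷_) (∈-insertAll-middle x as bs))

∈-perms⇒↭ : ∀ u {w} → w ∈ perms u → w ↭ u
∈-perms⇒↭ [] (here refl) = ↭-refl
∈-perms⇒↭ (x ∷ xs) m with find (∈-concatMap⁻ (insertAll x) {xs = perms xs} m)
... | v , v∈ , w∈ = ↭-trans (∈-insertAll⇒↭ x v w∈) (↭-prep x (∈-perms⇒↭ xs v∈))

↭⇒∈-perms : ∀ u {w} → w ↭ u → w ∈ perms u
↭⇒∈-perms [] p rewrite ↭ₚ.↭-empty-inv p = here refl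
↭⇒∈-perms (x ∷ xs) p with ∈-∃++ (↭ₚ.∈-resp-↭ (↭-sym p) (here refl))
... | as , bs , refl = ∈-concatMap⁺ (insertAll x) {xs = perms xs} (lose (↭⇒∈-perms xs (↭ₚ.drop-mid as [] p)) (∈-insertAll-middle x as bs))

coeff-P : ∀ u w → coeff (P u) w ≡ indicator (w ∈? perms u)
coeff-P u w = trans (multiplicity-unique w (deduplicate _≟W_ (perms u)) (UniqueDecₚ.deduplicate-! _≟W_ (perms u)))
  (indicator-cong (w ∈? deduplicate _≟W_ (perms u)) (w ∈? perms u) (∈-deduplicate⁻ _≟W_ (perms u)) (∈-deduplicate⁺ _≟W_))

all-ones⇒replicate : ∀ xs → All (_≡ 1) xs → xs ≡ replicate (length xs) 1
all-ones⇒replicate [] [] = refl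
all-ones⇒replicate (x ∷ xs) (refl ∷ ps) = cong (1 ∷_) (all-ones⇒replicate xs ps)

↭-ones⇒≡ : ∀ n {w} → w ↭ replicate n 1 → w ≡ replicate n 1
↭-ones⇒≡ n {w} p = trans (all-ones⇒replicate w (↭ₚ.All-resp-↭ (↭-sym p) (Allₚ.replicate⁺ n refl)))
                         (cong (λ k → replicate k 1) (trans (↭ₚ.↭-length p) (Listₚ.length-replicate n)))

deduplicate-constant : ∀ (x : Word) L → x ∈ L → (∀ {y} → y ∈ L → y ≡ x) → deduplicate _≟W_ L ≡ x ∷ []
deduplicate-constant x (y ∷ L) _ all≡x rewrite all≡x (here refl) =
  cong (x ∷_) (Listₚ.filter-none (λ z → ¬? (x ≟W z)) (tabulate (λ z∈ x≢z → x≢z (sym (all≡x (there (∈-deduplicate⁻ _≟W_ L z∈)))))))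

J≡F-ones : ∀ n → J n ≡ F (replicate n 1)
J≡F-ones n = cong sumF (deduplicate-constant (replicate n 1) (perms (replicate n 1))
  (↭⇒∈-perms (replicate n 1) ↭-refl) (λ m → ↭-ones⇒≡ n (∈-perms⇒↭ _ m)))

multiplicity-++ : ∀ w A B → multiplicity w (A ++ B) ≡ multiplicity w A +ℤ multiplicity w B
multiplicity-++ w A B = trans (cong (λ q → coeff q w) (Listₚ.map-++ _ A B)) (coeff-++ (sumF A) (sumF B) w)

multiplicity-map-∷ : ∀ x w L → multiplicity w (map (x ∷_) L) ≡ sumℤ (map (λ a → indicator ((x ∷ a) ≟W w)) L)
multiplicity-map-∷ x w L = trans (multiplicity-as-sum w (map (x ∷_) L)) (cong sumℤ (sym (Listₚ.map-∘ L)))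

multiplicity-[]-map-∷ : ∀ x L → multiplicity [] (map (x ∷_) L) ≡ 0ℤ
multiplicity-[]-map-∷ x L = trans (multiplicity-map-∷ x [] L) (sumℤ-map-zero L (λ _ → refl))

multiplicity-∷-map-∷ : ∀ x w L → multiplicity (x ∷ w) (map (x ∷_) L) ≡ multiplicity w L
multiplicity-∷-map-∷ x w L = trans (multiplicity-map-∷ x (x ∷ w) L) (trans (sumℤ-map-cong L
  (λ {a} _ → indicator-cong ((x ∷ a) ≟W (x ∷ w)) (a ≟W w) Listₚ.∷-injectiveʳ (cong (x ∷_)))) (sym (multiplicity-as-sum w L)))

multiplicity-∷-map-∷-other : ∀ x h w L → ¬ h ≡ x → multiplicity (h ∷ w) (map (x ∷_) L) ≡ 0ℤ
multiplicity-∷-map-∷-other x h w L h≢x = trans (multiplicity-map-∷ x (h ∷ w) L)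
  (sumℤ-map-zero L (λ {a} _ → indicator-no ((x ∷ a) ≟W (h ∷ w)) (λ e → h≢x (sym (Listₚ.∷-injectiveˡ e)))))

ones : Word → Word
ones = filter (ℕ._≟ 1)

nonOnes : Word → Word
nonOnes = filter (λ x → ¬? (x ℕ.≟ 1))

ones-accept : ∀ {x} w → x ≡ 1 → ones (x ∷ w) ≡ x ∷ ones w
ones-accept w = Listₚ.filter-accept (ℕ._≟ 1)

ones-reject : ∀ {x} w → ¬ x ≡ 1 → ones (x ∷ w) ≡ ones w
ones-reject w = Listₚ.filter-reject (ℕ._≟ 1)

nonOnes-reject : ∀ {x} w → x ≡ 1 → nonOnes (x ∷ w) ≡ nonOnes w
nonOnes-reject w x≡1 = Listₚ.filter-reject (λ x → ¬? (x ℕ.≟ 1)) (λ x≢1 → x≢1 x≡1)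

nonOnes-accept : ∀ {x} w → ¬ x ≡ 1 → nonOnes (x ∷ w) ≡ x ∷ nonOnes w
nonOnes-accept w = Listₚ.filter-accept (λ x → ¬? (x ℕ.≟ 1))

ones-of-allOnes : ∀ v → All (_≡ 1) v → ones v ≡ v
ones-of-allOnes v = Listₚ.filter-all (ℕ._≟ 1)

nonOnes-of-allOnes : ∀ v → All (_≡ 1) v → nonOnes v ≡ []
nonOnes-of-allOnes v p = Listₚ.filter-none (λ x → ¬? (x ℕ.≟ 1)) (All.map (λ x≡1 x≢1 → x≢1 x≡1) p)

ones-of-noOnes : ∀ v → All (λ x → ¬ x ≡ 1) v → ones v ≡ []
ones-of-noOnes v = Listₚ.filter-none (ℕ._≟ 1)

nonOnes-of-noOnes : ∀ v → All (λ x → ¬ x ≡ 1) v → nonOnes v ≡ v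
nonOnes-of-noOnes v = Listₚ.filter-all (λ x → ¬? (x ℕ.≟ 1))

ones≡[]⇒nonOnes≡id : ∀ w → ones w ≡ [] → nonOnes w ≡ w
ones≡[]⇒nonOnes≡id w e = nonOnes-of-noOnes w (tabulate (λ x∈ x≡1 → Anyₚ.¬Any[] (subst (_ ∈_) e (∈-filter⁺ (ℕ._≟ 1) x∈ x≡1))))

nonOnes≡[]⇒ones≡id : ∀ w → nonOnes w ≡ [] → ones w ≡ w
nonOnes≡[]⇒ones≡id w e = ones-of-allOnes w (tabulate (λ {x} x∈ → decidable-stable (x ℕ.≟ 1)
  (λ x≢1 → Anyₚ.¬Any[] (subst (_ ∈_) e (∈-filter⁺ (λ x → ¬? (x ℕ.≟ 1)) x∈ x≢1)))))

SplitsAs : Word → Word → Word → Set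
SplitsAs w u v = (ones w ≡ u) × (nonOnes w ≡ v)

splitsAs? : ∀ w u v → Dec (SplitsAs w u v)
splitsAs? w u v = (ones w ≟W u) ×-dec (nonOnes w ≟W v)

multiplicity-shuffle : ∀ u v w → All (_≡ 1) u → All (λ x → ¬ x ≡ 1) v → multiplicity w (shuffle u v) ≡ indicator (splitsAs? w u v)
multiplicity-shuffle [] v w _ v≢1 = trans (coeff-F v w) (indicator-cong (v ≟W w) (splitsAs? w [] v)
  (λ { refl → ones-of-noOnes v v≢1 , nonOnes-of-noOnes v v≢1 })
  (λ { (e₁ , e₂) → trans (sym e₂) (ones≡[]⇒nonOnes≡id w e₁) }))
multiplicity-shuffle (x ∷ u) [] w u≡1 _ = trans (coeff-F (x ∷ u) w) (indicator-cong ((x ∷ u) ≟W w) (splitsAs? w (x ∷ u) [])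
  (λ { refl → ones-of-allOnes (x ∷ u) u≡1 , nonOnes-of-allOnes (x ∷ u) u≡1 })
  (λ { (e₁ , e₂) → trans (sym e₁) (nonOnes≡[]⇒ones≡id w e₂) }))
multiplicity-shuffle (x ∷ u) (y ∷ v) w (x≡1 ∷ u≡1) (y≢1 ∷ v≢1) =
  trans (multiplicity-++ w (map (x ∷_) (shuffle u (y ∷ v))) (map (y ∷_) (shuffle (x ∷ u) v))) (by-first-letter w)
  where
  by-first-letter : ∀ w → multiplicity w (map (x ∷_) (shuffle u (y ∷ v))) +ℤ multiplicity w (map (y ∷_) (shuffle (x ∷ u) v))
                          ≡ indicator (splitsAs? w (x ∷ u) (y ∷ v))
  by-first-letter [] = trans (cong₂ _+ℤ_ (multiplicity-[]-map-∷ x (shuffle u (y ∷ v))) (multiplicity-[]-map-∷ y (shuffle (x ∷ u) v)))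
    (sym (indicator-no (splitsAs? [] (x ∷ u) (y ∷ v)) (λ { (() , _) })))
  by-first-letter (h ∷ w′) with h ℕ.≟ x
  ... | yes refl = trans (cong₂ _+ℤ_ (trans (multiplicity-∷-map-∷ h w′ (shuffle u (y ∷ v))) (multiplicity-shuffle u (y ∷ v) w′ u≡1 (y≢1 ∷ v≢1)))
                                      (multiplicity-∷-map-∷-other y h w′ (shuffle (h ∷ u) v) (λ h≡y → y≢1 (trans (sym h≡y) x≡1))))
    (trans (ℤₚ.+-identityʳ _) (indicator-cong (splitsAs? w′ u (y ∷ v)) (splitsAs? (h ∷ w′) (h ∷ u) (y ∷ v))
      (λ { (e₁ , e₂) → trans (ones-accept w′ x≡1) (cong (h ∷_) e₁) , trans (nonOnes-reject w′ x≡1) e₂ })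
      (λ { (e₁ , e₂) → Listₚ.∷-injectiveʳ (trans (sym (ones-accept w′ x≡1)) e₁) , trans (sym (nonOnes-reject w′ x≡1)) e₂ })))
  ... | no h≢x with h ℕ.≟ y
  ...   | yes refl = trans (cong₂ _+ℤ_ (multiplicity-∷-map-∷-other x h w′ (shuffle u (h ∷ v)) h≢x)
                                      (trans (multiplicity-∷-map-∷ h w′ (shuffle (x ∷ u) v)) (multiplicity-shuffle (x ∷ u) v w′ (x≡1 ∷ u≡1) v≢1)))
    (trans (ℤₚ.+-identityˡ _) (indicator-cong (splitsAs? w′ (x ∷ u) v) (splitsAs? (h ∷ w′) (x ∷ u) (h ∷ v))
      (λ { (e₁ , e₂) → trans (ones-reject w′ y≢1) e₁ , trans (nonOnes-accept w′ y≢1) (cong (h ∷_) e₂) })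
      (λ { (e₁ , e₂) → trans (sym (ones-reject w′ y≢1)) e₁ , Listₚ.∷-injectiveʳ (trans (sym (nonOnes-accept w′ y≢1)) e₂) })))
  ...   | no h≢y = trans (cong₂ _+ℤ_ (multiplicity-∷-map-∷-other x h w′ (shuffle u (y ∷ v)) h≢x)
                                    (multiplicity-∷-map-∷-other y h w′ (shuffle (x ∷ u) v) h≢y))
    (sym (indicator-no (splitsAs? (h ∷ w′) (x ∷ u) (y ∷ v)) neither))
    where
    neither : ¬ SplitsAs (h ∷ w′) (x ∷ u) (y ∷ v)
    neither (e₁ , e₂) with h ℕ.≟ 1
    ... | yes h≡1 = h≢x (Listₚ.∷-injectiveˡ (trans (sym (ones-accept w′ h≡1)) e₁))
    ... | no h≢1 = h≢y (Listₚ.∷-injectiveˡ (trans (sym (nonOnes-accept w′ h≢1)) e₂))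

piFrom : ℕ → List ℕ → Word
piFrom m [] = []
piFrom m (c ∷ I) = replicate c m ++ piFrom (m + c) I

piFrom-+ : ∀ k m I → piFrom (k + m) I ≡ shift k (piFrom m I)
piFrom-+ k m [] = refl
piFrom-+ k m (c ∷ I) = begin
  replicate c (k + m) ++ piFrom (k + m + c) I         ≡⟨ cong (λ q → replicate c (k + m) ++ piFrom q I) (ℕₚ.+-assoc k m c) ⟩
  replicate c (k + m) ++ piFrom (k + (m + c)) I       ≡⟨ cong (replicate c (k + m) ++_) (piFrom-+ k (m + c) I) ⟩
  replicate c (k + m) ++ shift k (piFrom (m + c) I)   ≡⟨ cong (_++ shift k (piFrom (m + c) I)) (Listₚ.map-replicate (k +_) c m) ⟨
  shift k (replicate c m) ++ shift k (piFrom (m + c) I) ≡⟨ Listₚ.map-++ (k +_) (replicate c m) (piFrom (m + c) I) ⟨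
  shift k (replicate c m ++ piFrom (m + c) I)         ∎
  where open ≡-Reasoning

piFrom-≥ : ∀ m I → All (m ≤_) (piFrom m I)
piFrom-≥ m [] = []
piFrom-≥ m (c ∷ I) = Allₚ.++⁺ (Allₚ.replicate⁺ c ℕₚ.≤-refl) (All.map (ℕₚ.≤-trans (ℕₚ.m≤m+n m c)) (piFrom-≥ (m + c) I))

shift-≥ : ∀ i b → All (i ≤_) (shift i b)
shift-≥ i [] = []
shift-≥ i (x ∷ b) = ℕₚ.m≤m+n i x ∷ shift-≥ i b

shift-positive-> : ∀ i b → All (1 ≤_) b → All (i <_) (shift i b)
shift-positive-> i [] [] = []
shift-positive-> i (x ∷ b) (1≤x ∷ pos) = ℕₚ.m<m+n i 1≤x ∷ shift-positive-> i b pos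

unshift : ℕ → Word → Word
unshift i = map (_∸ i)

unshift-shift : ∀ i b → unshift i (shift i b) ≡ b
unshift-shift i [] = refl
unshift-shift i (x ∷ b) = cong₂ _∷_ (ℕₚ.m+n∸m≡n i x) (unshift-shift i b)

shift-unshift : ∀ i r → All (i ≤_) r → shift i (unshift i r) ≡ r
shift-unshift i [] [] = refl
shift-unshift i (x ∷ r) (i≤x ∷ i≤r) = cong₂ _∷_ (ℕₚ.m+[n∸m]≡n i≤x) (shift-unshift i r i≤r)

all-≥? : ∀ i r → Dec (All (i ≤_) r)
all-≥? i = all? (i ℕ.≤?_)

indicator-≡-shift : ∀ i r b → indicator (r ≟W shift i b) ≡ indicator (all-≥? i r) *ℤ indicator (b ≟W unshift i r)
indicator-≡-shift i r b = trans (indicator-cong (r ≟W shift i b) (all-≥? i r ×-dec (b ≟W unshift i r))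
  (λ { refl → shift-≥ i b , sym (unshift-shift i b) })
  (λ { (i≤r , refl) → sym (shift-unshift i r i≤r) })) (indicator-× (all-≥? i r) (b ≟W unshift i r))

shift-noOnes : ∀ i Q → 1 ≤ i → All (1 ≤_) Q → All (λ x → ¬ x ≡ 1) (shift i Q)
shift-noOnes i Q 1≤i pos = All.map (λ i<x x≡1 → ℕₚ.<-irrefl refl (ℕₚ.≤-trans (s≤s 1≤i) (ℕₚ.≤-trans i<x (ℕₚ.≤-reflexive x≡1)))) (shift-positive-> i Q pos)

↭-ones++nonOnes : ∀ w → w ↭ ones w ++ nonOnes w
↭-ones++nonOnes [] = ↭-refl
↭-ones++nonOnes (x ∷ w) with x ℕ.≟ 1
... | yes x≡1 rewrite ones-accept w x≡1 | nonOnes-reject w x≡1 = ↭-prep x (↭-ones++nonOnes w)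
... | no x≢1 rewrite ones-reject w x≢1 | nonOnes-accept w x≢1 = ↭-trans (↭-prep x (↭-ones++nonOnes w)) (↭-sym (↭ₚ.shift x (ones w) (nonOnes w)))

ShiftedSplit : ℕ → Word → Word → Set
ShiftedSplit i Q w = (ones w ≡ replicate i 1) × (All (i ≤_) (nonOnes w) × (unshift i (nonOnes w) ↭ Q))

↭-ones++shift⇒ShiftedSplit : ∀ i Q w → 1 ≤ i → All (1 ≤_) Q → w ↭ replicate i 1 ++ shift i Q → ShiftedSplit i Q w
↭-ones++shift⇒ShiftedSplit i Q w 1≤i pos p = ones≡ , i≤ , unshift↭
  where
  a = replicate i 1
  sQ = shift i Q
  ones-a++sQ : ones (a ++ sQ) ≡ a
  ones-a++sQ = trans (Listₚ.filter-++ (ℕ._≟ 1) a sQ)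
    (trans (cong₂ _++_ (ones-of-allOnes a (Allₚ.replicate⁺ i refl)) (ones-of-noOnes sQ (shift-noOnes i Q 1≤i pos))) (Listₚ.++-identityʳ a))
  nonOnes-a++sQ : nonOnes (a ++ sQ) ≡ sQ
  nonOnes-a++sQ = trans (Listₚ.filter-++ (λ x → ¬? (x ℕ.≟ 1)) a sQ)
    (cong₂ _++_ (nonOnes-of-allOnes a (Allₚ.replicate⁺ i refl)) (nonOnes-of-noOnes sQ (shift-noOnes i Q 1≤i pos)))
  ones↭ : ones w ↭ a
  ones↭ = subst (ones w ↭_) ones-a++sQ (↭ₚ.filter-↭ (ℕ._≟ 1) p)
  nonOnes↭ : nonOnes w ↭ sQ
  nonOnes↭ = subst (nonOnes w ↭_) nonOnes-a++sQ (↭ₚ.filter-↭ (λ x → ¬? (x ℕ.≟ 1)) p)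
  ones≡ : ones w ≡ a
  ones≡ = trans (all-ones⇒replicate (ones w) (Allₚ.all-filter (ℕ._≟ 1) w))
                (cong (λ k → replicate k 1) (trans (↭ₚ.↭-length ones↭) (Listₚ.length-replicate i)))
  i≤ : All (i ≤_) (nonOnes w)
  i≤ = ↭ₚ.All-resp-↭ (↭-sym nonOnes↭) (shift-≥ i Q)
  unshift↭ : unshift i (nonOnes w) ↭ Q
  unshift↭ = subst (unshift i (nonOnes w) ↭_) (unshift-shift i Q) (↭ₚ.map⁺ (_∸ i) nonOnes↭)

ShiftedSplit⇒↭-ones++shift : ∀ i Q w → ShiftedSplit i Q w → w ↭ replicate i 1 ++ shift i Q
ShiftedSplit⇒↭-ones++shift i Q w (ones≡ , i≤ , unshift↭) = ↭-trans (↭-ones++nonOnes w)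
  (subst (λ q → ones w ++ nonOnes w ↭ q ++ shift i Q) ones≡
    (↭ₚ.++⁺ˡ (ones w) (subst (_↭ shift i Q) (shift-unshift i (nonOnes w) i≤) (↭ₚ.map⁺ (i +_) unshift↭))))

coeff-F· : ∀ a y w → coeff (F a · y) w ≡ sumℤ (map (λ p → (1ℤ *ℤ proj₁ p) *ℤ multiplicity w (shuffle a (shift (length a) (proj₂ p)))) y)
coeff-F· a y w = trans (coeff-++ (concatMap row y) [] w) (trans (ℤₚ.+-identityʳ _) (trans (coeff-concatMap row y w)
  (cong sumℤ (Listₚ.map-cong (λ { (d , b) → coeff-scaled (1ℤ *ℤ d) (shuffle a (shift (length a) b)) w }) y))))
  where
  row : ℤ × Word → Lin
  row = λ { (d , b) → map (λ w → (1ℤ *ℤ d , w)) (shuffle a (shift (length a) b)) }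

All-∈-shuffle : ∀ {P : ℕ → Set} u v {w} → All P u → All P v → w ∈ shuffle u v → All P w
All-∈-shuffle [] v pu pv (here refl) = pv
All-∈-shuffle (x ∷ u) [] pu pv (here refl) = pu
All-∈-shuffle (x ∷ u) (y ∷ v) (px ∷ pu) (py ∷ pv) m with ∈-++⁻ (map (x ∷_) (shuffle u (y ∷ v))) m
... | inj₁ m₁ with ∈-map⁻ (x ∷_) m₁
...   | _ , m′ , refl = px ∷ All-∈-shuffle u (y ∷ v) pu (py ∷ pv) m′
All-∈-shuffle (x ∷ u) (y ∷ v) (px ∷ pu) (py ∷ pv) m | inj₂ m₂ with ∈-map⁻ (y ∷_) m₂
... | _ , m′ , refl = py ∷ All-∈-shuffle (x ∷ u) v (px ∷ pu) pv m′

PositiveWords : Lin → Set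
PositiveWords = All (λ p → All (1 ≤_) (proj₂ p))

jS-positive : ∀ I → PositiveWords (jS I)
jS-positive [] = [] ∷ []
jS-positive (i ∷ I) rewrite J≡F-ones i = tabulate positive
  where
  a = replicate i 1
  positive : ∀ {q} → q ∈ F a · jS I → All (1 ≤_) (proj₂ q)
  positive {q} m with find (∈-concatMap⁻ (λ { (d , b) → map (λ w → (1ℤ *ℤ d , w)) (shuffle a (shift (length a) b)) }) {xs = jS I}
                             (subst (q ∈_) (Listₚ.++-identityʳ _) m))
  ... | (d , b) , db∈ , q∈ with ∈-map⁻ (λ w → (1ℤ *ℤ d , w)) q∈
  ...   | w , w∈ , refl = All-∈-shuffle a (shift (length a) b) (Allₚ.replicate⁺ i ℕₚ.≤-refl)
                            (All.map (ℕₚ.≤-trans (s≤s z≤n)) (shift-positive-> (length a) b (All.lookup (jS-positive I) db∈))) w∈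

multiplicity-shuffle-ones-shift : ∀ i b w → 1 ≤ i → All (1 ≤_) b →
  multiplicity w (shuffle (replicate i 1) (shift i b))
    ≡ indicator (ones w ≟W replicate i 1) *ℤ (indicator (all-≥? i (nonOnes w)) *ℤ indicator (b ≟W unshift i (nonOnes w)))
multiplicity-shuffle-ones-shift i b w 1≤i pos = begin
  multiplicity w (shuffle (replicate i 1) (shift i b))
    ≡⟨ multiplicity-shuffle (replicate i 1) (shift i b) w (Allₚ.replicate⁺ i refl) (shift-noOnes i b 1≤i pos) ⟩
  indicator (splitsAs? w (replicate i 1) (shift i b))
    ≡⟨ indicator-× (ones w ≟W replicate i 1) (nonOnes w ≟W shift i b) ⟩
  indicator (ones w ≟W replicate i 1) *ℤ indicator (nonOnes w ≟W shift i b)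
    ≡⟨ cong (indicator (ones w ≟W replicate i 1) *ℤ_) (indicator-≡-shift i (nonOnes w) b) ⟩
  indicator (ones w ≟W replicate i 1) *ℤ (indicator (all-≥? i (nonOnes w)) *ℤ indicator (b ≟W unshift i (nonOnes w)))
    ∎
  where open ≡-Reasoning

piFrom-1-∷ : ∀ i I → piFrom 1 (i ∷ I) ≡ replicate i 1 ++ shift i (piFrom 1 I)
piFrom-1-∷ i I = cong (replicate i 1 ++_) (trans (cong (λ q → piFrom q I) (ℕₚ.+-comm 1 i)) (piFrom-+ i 1 I))

coeff-jS : ∀ I → All (1 ≤_) I → ∀ w → coeff (jS I) w ≡ indicator (w ∈? perms (piFrom 1 I))
coeff-jS [] _ w = trans (coeff-F [] w) (indicator-cong ([] ≟W w) (w ∈? perms []) (λ { refl → here refl }) (λ { (here e) → sym e }))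
coeff-jS (i ∷ I) (1≤i ∷ pos) w rewrite J≡F-ones i = begin
  coeff (F a · y) w
    ≡⟨ coeff-F· a y w ⟩
  sumℤ (map (λ p → (1ℤ *ℤ proj₁ p) *ℤ multiplicity w (shuffle a (shift (length a) (proj₂ p)))) y)
    ≡⟨ sumℤ-map-cong y summand ⟩
  sumℤ (map (λ p → X *ℤ (Y *ℤ (proj₁ p *ℤ indicator (proj₂ p ≟W u)))) y)
    ≡⟨ trans (sumℤ-map-*ˡ X _ y) (cong (X *ℤ_) (sumℤ-map-*ˡ Y _ y)) ⟩
  X *ℤ (Y *ℤ sumℤ (map (λ p → proj₁ p *ℤ indicator (proj₂ p ≟W u)) y))
    ≡⟨ cong (λ q → X *ℤ (Y *ℤ q)) (trans (sym (coeff-as-sum y u)) (coeff-jS I pos u)) ⟩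
  X *ℤ (Y *ℤ indicator (u ∈? perms Q))
    ≡⟨ trans (indicator-× (ones w ≟W a) _) (cong (X *ℤ_) (indicator-× (all-≥? i (nonOnes w)) (u ∈? perms Q))) ⟨
  indicator ((ones w ≟W a) ×-dec (all-≥? i (nonOnes w) ×-dec (u ∈? perms Q)))
    ≡⟨ indicator-cong _ (w ∈? perms (piFrom 1 (i ∷ I))) to-perms from-perms ⟩
  indicator (w ∈? perms (piFrom 1 (i ∷ I)))
    ∎
  where
  open ≡-Reasoning
  a = replicate i 1
  y = jS I
  Q = piFrom 1 I
  u = unshift i (nonOnes w)
  X = indicator (ones w ≟W a)
  Y = indicator (all-≥? i (nonOnes w))

  summand : ∀ {p} → p ∈ y → (1ℤ *ℤ proj₁ p) *ℤ multiplicity w (shuffle a (shift (length a) (proj₂ p)))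
                            ≡ X *ℤ (Y *ℤ (proj₁ p *ℤ indicator (proj₂ p ≟W u)))
  summand {d , b} m rewrite Listₚ.length-replicate i {1} | ℤₚ.*-identityˡ d
                          | multiplicity-shuffle-ones-shift i b w 1≤i (All.lookup (jS-positive I) m)
    = solve 4 (λ d X Y Z → d :* (X :* (Y :* Z)) := X :* (Y :* (d :* Z))) refl d X Y (indicator (b ≟W u))
    where open ℤSolver.+-*-Solver

  to-perms : ones w ≡ a × (All (i ≤_) (nonOnes w) × u ∈ perms Q) → w ∈ perms (piFrom 1 (i ∷ I))
  to-perms (ones≡ , i≤ , u∈) = ↭⇒∈-perms _ (subst (w ↭_) (sym (piFrom-1-∷ i I)) (ShiftedSplit⇒↭-ones++shift i Q w (ones≡ , i≤ , ∈-perms⇒↭ Q u∈)))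

  from-perms : w ∈ perms (piFrom 1 (i ∷ I)) → ones w ≡ a × (All (i ≤_) (nonOnes w) × u ∈ perms Q)
  from-perms m with ↭-ones++shift⇒ShiftedSplit i Q w 1≤i (piFrom-≥ 1 I) (subst (w ↭_) (piFrom-1-∷ i I) (∈-perms⇒↭ _ m))
  ... | ones≡ , i≤ , unshift↭ = ones≡ , i≤ , ↭⇒∈-perms Q unshift↭

open Parkization lexLeq _≟P_ δPair

pairWith1 : ℕ → ℕ × ℕ
pairWith1 x = (x , 1)

lexLeq-pairWith1 : ∀ x y (x≤?y : Dec (x ≤ y)) → lexLeq (x , 1) (y , 1) ≡ does x≤?y
lexLeq-pairWith1 x y x≤?y = does-⇔ (mk⇔ to from) ((x ℕ.<? y) ⊎-dec ((x ℕ.≟ y) ×-dec (1 ℕ.≤? 1))) x≤?y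
  where
  to : x < y ⊎ (x ≡ y × 1 ≤ 1) → x ≤ y
  to (inj₁ x<y) = ℕₚ.<⇒≤ x<y
  to (inj₂ (refl , _)) = ℕₚ.≤-refl
  from : x ≤ y → x < y ⊎ (x ≡ y × 1 ≤ 1)
  from x≤y with ℕₚ.m≤n⇒m<n∨m≡n x≤y
  ... | inj₁ x<y = inj₁ x<y
  ... | inj₂ x≡y = inj₂ (x≡y , s≤s z≤n)

insertℕ : ℕ → List ℕ → List ℕ
insertℕ x [] = x ∷ []
insertℕ x (y ∷ ys) = if does (x ℕ.≟ y) then y ∷ ys else (if does (x ℕ.≤? y) then x ∷ y ∷ ys else y ∷ insertℕ x ys)

distinctSortedℕ : List ℕ → List ℕ
distinctSortedℕ = foldr insertℕ []

-- `with` cannot abstract `does (x ℕ.≟ y)` (it computes to x ≡ᵇ y), so case analyses on insertℕ go through this form.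
InsertCases : (x y : ℕ) → List ℕ → Dec (x ≡ y) → Dec (x ≤ y) → List ℕ
InsertCases x y T x≟y x≤?y = if does x≟y then y ∷ T else (if does x≤?y then x ∷ y ∷ T else y ∷ insertℕ x T)

insertS-pairWith1 : ∀ x T → insertS (x , 1) (map pairWith1 T) ≡ map pairWith1 (insertℕ x T)
insertS-pairWith1 x [] = refl
insertS-pairWith1 x (y ∷ T) = by-cases ((x , 1) ≟P (y , 1)) (x ℕ.≟ y) (x ℕ.≤? y)
  where
  by-cases : (x1≟y1 : Dec ((x , 1) ≡ (y , 1))) (x≟y : Dec (x ≡ y)) (x≤?y : Dec (x ≤ y)) →
             (if does x1≟y1 then (y , 1) ∷ map pairWith1 T
              else (if lexLeq (x , 1) (y , 1) then (x , 1) ∷ (y , 1) ∷ map pairWith1 T else (y , 1) ∷ insertS (x , 1) (map pairWith1 T)))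
             ≡ map pairWith1 (InsertCases x y T x≟y x≤?y)
  by-cases (yes _) (yes _) _ = refl
  by-cases (yes e) (no x≢y) _ = ⊥-elim (x≢y (cong proj₁ e))
  by-cases (no x1≢y1) (yes refl) _ = ⊥-elim (x1≢y1 refl)
  by-cases (no _) (no _) x≤?y rewrite lexLeq-pairWith1 x y x≤?y with x≤?y
  ... | yes _ = refl
  ... | no _ = cong ((y , 1) ∷_) (insertS-pairWith1 x T)

distinctSorted-pairWith1 : ∀ a → distinctSorted (map pairWith1 a) ≡ map pairWith1 (distinctSortedℕ a)
distinctSorted-pairWith1 [] = refl
distinctSorted-pairWith1 (x ∷ a) = trans (cong (insertS (x , 1)) (distinctSorted-pairWith1 a)) (insertS-pairWith1 x (distinctSortedℕ a))

∈-insertℕ⁻ : ∀ x T {z} → z ∈ insertℕ x T → z ≡ x ⊎ z ∈ T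
∈-insertℕ⁻ x [] (here e) = inj₁ e
∈-insertℕ⁻ x (y ∷ T) {z} m = by-cases (x ℕ.≟ y) (x ℕ.≤? y) m
  where
  by-cases : ∀ x≟y x≤?y → z ∈ InsertCases x y T x≟y x≤?y → z ≡ x ⊎ z ∈ y ∷ T
  by-cases (yes _) _ m = inj₂ m
  by-cases (no _) (yes _) (here e) = inj₁ e
  by-cases (no _) (yes _) (there m) = inj₂ m
  by-cases (no _) (no _) (here e) = inj₂ (here e)
  by-cases (no _) (no _) (there m) with ∈-insertℕ⁻ x T m
  ... | inj₁ e = inj₁ e
  ... | inj₂ m′ = inj₂ (there m′)

∈-insertℕ⁺ : ∀ x T {z} → z ≡ x ⊎ z ∈ T → z ∈ insertℕ x T
∈-insertℕ⁺ x [] (inj₁ e) = here e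
∈-insertℕ⁺ x (y ∷ T) {z} h = by-cases (x ℕ.≟ y) (x ℕ.≤? y) h
  where
  by-cases : ∀ x≟y x≤?y → z ≡ x ⊎ z ∈ y ∷ T → z ∈ InsertCases x y T x≟y x≤?y
  by-cases (yes refl) _ (inj₁ e) = here e
  by-cases (yes refl) _ (inj₂ m) = m
  by-cases (no _) (yes _) (inj₁ e) = here e
  by-cases (no _) (yes _) (inj₂ m) = there m
  by-cases (no _) (no _) (inj₁ e) = there (∈-insertℕ⁺ x T (inj₁ e))
  by-cases (no _) (no _) (inj₂ (here e)) = here e
  by-cases (no _) (no _) (inj₂ (there m)) = there (∈-insertℕ⁺ x T (inj₂ m))

insertℕ-sorted : ∀ x T → AllPairs _<_ T → AllPairs _<_ (insertℕ x T)
insertℕ-sorted x [] _ = [] ∷ []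
insertℕ-sorted x (y ∷ T) (y<T ∷ sT) = by-cases (x ℕ.≟ y) (x ℕ.≤? y)
  where
  by-cases : ∀ x≟y x≤?y → AllPairs _<_ (InsertCases x y T x≟y x≤?y)
  by-cases (yes _) _ = y<T ∷ sT
  by-cases (no x≢y) (yes x≤y) = (x<y ∷ All.map (ℕₚ.<-trans x<y) y<T) ∷ y<T ∷ sT
    where x<y = ℕₚ.≤∧≢⇒< x≤y x≢y
  by-cases (no _) (no x≰y) = tabulate y<insert ∷ insertℕ-sorted x T sT
    where
    y<insert : ∀ {z} → z ∈ insertℕ x T → y < z
    y<insert m with ∈-insertℕ⁻ x T m
    ... | inj₁ refl = ℕₚ.≰⇒> x≰y
    ... | inj₂ m′ = All.lookup y<T m′

∈-distinctSortedℕ⁻ : ∀ a {z} → z ∈ distinctSortedℕ a → z ∈ a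
∈-distinctSortedℕ⁻ (x ∷ a) m with ∈-insertℕ⁻ x (distinctSortedℕ a) m
... | inj₁ refl = here refl
... | inj₂ m′ = there (∈-distinctSortedℕ⁻ a m′)

∈-distinctSortedℕ⁺ : ∀ a {z} → z ∈ a → z ∈ distinctSortedℕ a
∈-distinctSortedℕ⁺ (x ∷ a) (here e) = ∈-insertℕ⁺ x (distinctSortedℕ a) (inj₁ e)
∈-distinctSortedℕ⁺ (x ∷ a) (there m) = ∈-insertℕ⁺ x (distinctSortedℕ a) (inj₂ (∈-distinctSortedℕ⁺ a m))

distinctSortedℕ-sorted : ∀ a → AllPairs _<_ (distinctSortedℕ a)
distinctSortedℕ-sorted [] = []
distinctSortedℕ-sorted (x ∷ a) = insertℕ-sorted x (distinctSortedℕ a) (distinctSortedℕ-sorted a)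

countLt : ℕ → Word → ℕ
countLt x a = length (filter (ℕ._<? x) a)

countLe : ℕ → Word → ℕ
countLe x a = length (filter (ℕ._≤? x) a)

rank : Word → ℕ → ℕ
rank a x = suc (countLt x a)

countLt-accept : ∀ {x z} π → z < x → countLt x (z ∷ π) ≡ suc (countLt x π)
countLt-accept {x} π = cong length ∘ Listₚ.filter-accept (ℕ._<? x) {xs = π}

countLt-reject : ∀ {x z} π → ¬ z < x → countLt x (z ∷ π) ≡ countLt x π
countLt-reject {x} π = cong length ∘ Listₚ.filter-reject (ℕ._<? x) {xs = π}

countLt-mono : ∀ π {x y} → x ≤ y → countLt x π ≤ countLt y π
countLt-mono [] _ = z≤n
countLt-mono (z ∷ π) {x} {y} x≤y with z ℕ.<? x | z ℕ.<? y
... | yes z<x | yes z<y rewrite countLt-accept π z<x | countLt-accept π z<y = s≤s (countLt-mono π x≤y)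
... | yes z<x | no z≮y = ⊥-elim (z≮y (ℕₚ.<-≤-trans z<x x≤y))
... | no z≮x | yes z<y rewrite countLt-reject π z≮x | countLt-accept π z<y = ℕₚ.m≤n⇒m≤1+n (countLt-mono π x≤y)
... | no z≮x | no z≮y rewrite countLt-reject π z≮x | countLt-reject π z≮y = countLt-mono π x≤y

countLt-< : ∀ π {x y} → x ∈ π → x < y → suc (countLt x π) ≤ countLt y π
countLt-< (z ∷ π) (here refl) z<y rewrite countLt-reject π (ℕₚ.<-irrefl {z} refl) | countLt-accept π z<y = s≤s (countLt-mono π (ℕₚ.<⇒≤ z<y))
countLt-< (z ∷ π) {x} {y} (there x∈) x<y with z ℕ.<? x | z ℕ.<? y
... | yes z<x | yes z<y rewrite countLt-accept π z<x | countLt-accept π z<y = s≤s (countLt-< π x∈ x<y)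
... | yes z<x | no z≮y = ⊥-elim (z≮y (ℕₚ.<-trans z<x x<y))
... | no z≮x | yes z<y rewrite countLt-reject π z≮x | countLt-accept π z<y = ℕₚ.m≤n⇒m≤1+n (countLt-< π x∈ x<y)
... | no z≮x | no z≮y rewrite countLt-reject π z≮x | countLt-reject π z≮y = countLt-< π x∈ x<y

countLt-↭ : ∀ {a π} x → a ↭ π → countLt x a ≡ countLt x π
countLt-↭ x p = ↭ₚ.↭-length (↭ₚ.filter-↭ (ℕ._<? x) p)

countLt-++ : ∀ x xs ys → countLt x (xs ++ ys) ≡ countLt x xs + countLt x ys
countLt-++ x xs ys = trans (cong length (Listₚ.filter-++ (ℕ._<? x) xs ys)) (Listₚ.length-++ (filter (ℕ._<? x) xs))

countLt-replicate-≥ : ∀ x c k → x ≤ k → countLt x (replicate c k) ≡ 0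
countLt-replicate-≥ x c k x≤k = cong length (Listₚ.filter-none (ℕ._<? x) (Allₚ.replicate⁺ c (ℕₚ.≤⇒≯ x≤k)))

countLt-replicate-< : ∀ x c k → k < x → countLt x (replicate c k) ≡ c
countLt-replicate-< x c k k<x = trans (cong length (Listₚ.filter-all (ℕ._<? x) (Allₚ.replicate⁺ c k<x))) (Listₚ.length-replicate c)

countLt-all-≥ : ∀ x W → All (x ≤_) W → countLt x W ≡ 0
countLt-all-≥ x W x≤W = cong length (Listₚ.filter-none (ℕ._<? x) (All.map ℕₚ.≤⇒≯ x≤W))

length-filter-cong : ∀ {A : Set} {P Q : A → Set} (P? : ∀ x → Dec (P x)) (Q? : ∀ x → Dec (Q x)) xs →
                     (∀ {y} → y ∈ xs → P y → Q y) → (∀ {y} → y ∈ xs → Q y → P y) → length (filter P? xs) ≡ length (filter Q? xs)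
length-filter-cong P? Q? [] f g = refl
length-filter-cong P? Q? (x ∷ xs) f g with P? x | Q? x
... | yes _ | yes _ = cong suc (length-filter-cong P? Q? xs (f ∘ there) (g ∘ there))
... | yes p | no ¬q = ⊥-elim (¬q (f (here refl) p))
... | no ¬p | yes q = ⊥-elim (¬p (g (here refl) q))
... | no _ | no _ = length-filter-cong P? Q? xs (f ∘ there) (g ∘ there)

cntLeq-pairWith1 : ∀ a b → cntLeq (map pairWith1 a) (b , 1) ≡ countLe b a
cntLeq-pairWith1 [] b = refl
cntLeq-pairWith1 (x ∷ a) b with x ℕ.≤? b
... | yes x≤b = trans (cong length (Listₚ.filter-accept (λ q → lexLeq q (b , 1) ≟ᵇ true) {xs = map pairWith1 a} (lexLeq-pairWith1 x b (yes x≤b))))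
                  (trans (cong suc (cntLeq-pairWith1 a b)) (sym (cong length (Listₚ.filter-accept (ℕ._≤? b) {xs = a} x≤b))))
... | no x≰b = trans (cong length (Listₚ.filter-reject (λ q → lexLeq q (b , 1) ≟ᵇ true) {xs = map pairWith1 a}
                       (λ e → true≢false (trans (sym e) (lexLeq-pairWith1 x b (no x≰b))))))
                 (trans (cntLeq-pairWith1 a b) (sym (cong length (Listₚ.filter-reject (ℕ._≤? b) {xs = a} x≰b))))
  where
  true≢false : true ≡ false → ⊥
  true≢false ()

nextP-other-row : ∀ w b p c → ¬ b ≡ c → nextP w (b , 1) p (c , 1) ≡ suc (cntLeq w (b , 1))
nextP-other-row w b p c b≢c with b ℕ.≡ᵇ c in e
... | false = refl
... | true = ⊥-elim (b≢c (ℕₚ.≡ᵇ⇒≡ b c (subst T (sym e) _)))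

look-correct : ∀ (V : ℕ × ℕ → ℕ) E k → All (λ e → proj₂ e ≡ V (proj₁ e)) E → k ∈ map proj₁ E → look E k ≡ V k
look-correct V ((y , p) ∷ E) k (p≡Vy ∷ rest) m = by-cases (k ≟P y)
  where
  by-cases : (k≟y : Dec (k ≡ y)) → (if does k≟y then p else look E k) ≡ V k
  by-cases (yes refl) = p≡Vy
  by-cases (no k≢y) = look-correct V E k rest (Any.tail k≢y m)

assignList : List (ℕ × ℕ) → List (ℕ × ℕ) → List ((ℕ × ℕ) × ℕ)
assignList w [] = []
assignList w (b ∷ bs) = (b , 1) ∷ assignFrom w b 1 bs

assign≡assignList : ∀ w → assign w ≡ assignList w (distinctSorted w)
assign≡assignList w with distinctSorted w
... | [] = refl
... | b ∷ bs = refl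

countLe≡countLt-gap : ∀ a {b c} → b < c → (∀ {y} → y ∈ a → b < y → c ≤ y) → countLe b a ≡ countLt c a
countLe≡countLt-gap a {b} {c} b<c gap = length-filter-cong (ℕ._≤? b) (ℕ._<? c) a (λ _ y≤b → ℕₚ.≤-<-trans y≤b b<c) y<c⇒y≤b
  where
  y<c⇒y≤b : ∀ {y} → y ∈ a → y < c → y ≤ b
  y<c⇒y≤b {y} y∈ y<c with y ℕ.≤? b
  ... | yes y≤b = y≤b
  ... | no y≰b = ⊥-elim (ℕₚ.<⇒≱ y<c (gap y∈ (ℕₚ.≰⇒> y≰b)))

-- Successor steps of pairs keep the first coordinate, so the letters (x , 1) of a ⊗ 1ⁿ are pairwise
-- unreachable and each is parked right after all smaller ones: at rank a x.
module ParkWithOnes (a : Word) where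

  w : List (ℕ × ℕ)
  w = map pairWith1 a

  Ranked : List ((ℕ × ℕ) × ℕ) → Set
  Ranked = All (λ e → proj₂ e ≡ rank a (proj₁ (proj₁ e)))

  covered-by-tail : ∀ {b c cs} → AllPairs _<_ (c ∷ cs) → (∀ {y} → y ∈ a → b < y → y ∈ c ∷ cs) → ∀ {y} → y ∈ a → b < y → c ≤ y
  covered-by-tail (c<cs ∷ _) covered y∈ b<y with covered y∈ b<y
  ... | here refl = ℕₚ.≤-refl
  ... | there y∈cs = ℕₚ.<⇒≤ (All.lookup c<cs y∈cs)

  assignFrom-ranked : ∀ b p cs → AllPairs _<_ (b ∷ cs) → (∀ {y} → y ∈ a → b < y → y ∈ cs) →
                      map proj₁ (assignFrom w (b , 1) p (map pairWith1 cs)) ≡ map pairWith1 cs × Ranked (assignFrom w (b , 1) p (map pairWith1 cs))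
  assignFrom-ranked b p [] _ _ = refl , []
  assignFrom-ranked b p (c ∷ cs) ((b<c ∷ _) ∷ sorted) covered
    with assignFrom-ranked c (nextP w (b , 1) p (c , 1)) cs sorted covered′
    where
    covered′ : ∀ {y} → y ∈ a → c < y → y ∈ cs
    covered′ y∈ c<y with covered y∈ (ℕₚ.<-trans b<c c<y)
    ... | here refl = ⊥-elim (ℕₚ.<-irrefl refl c<y)
    ... | there y∈cs = y∈cs
  ... | keys , ranked = cong ((c , 1) ∷_) keys , next-rank ∷ ranked
    where
    next-rank : nextP w (b , 1) p (c , 1) ≡ rank a c
    next-rank = trans (nextP-other-row w b p c (ℕₚ.<⇒≢ b<c))
      (cong suc (trans (cntLeq-pairWith1 a b) (countLe≡countLt-gap a b<c (covered-by-tail sorted covered))))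

  assignList-ranked : ∀ T → AllPairs _<_ T → (∀ {x} → x ∈ a → x ∈ T) → (∀ {t} → t ∈ T → t ∈ a) →
                      (∀ {x} → x ∈ a → pairWith1 x ∈ map proj₁ (assignList w (map pairWith1 T))) × Ranked (assignList w (map pairWith1 T))
  assignList-ranked [] _ covered _ = (λ x∈ → ⊥-elim (Anyₚ.¬Any[] (covered x∈))) , []
  assignList-ranked (b ∷ cs) sorted@(b<cs ∷ _) covered from-a with assignFrom-ranked b 1 cs sorted covered′
    where
    covered′ : ∀ {y} → y ∈ a → b < y → y ∈ cs
    covered′ y∈ b<y with covered y∈
    ... | here refl = ⊥-elim (ℕₚ.<-irrefl refl b<y)
    ... | there y∈cs = y∈cs
  ... | keys , ranked = key∈ , first-rank ∷ ranked
    where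
    key∈ : ∀ {x} → x ∈ a → pairWith1 x ∈ map proj₁ (assignList w (map pairWith1 (b ∷ cs)))
    key∈ x∈ with covered x∈
    ... | here refl = here refl
    ... | there x∈cs = there (subst (pairWith1 _ ∈_) (sym keys) (∈-map⁺ pairWith1 x∈cs))
    first-rank : 1 ≡ rank a b
    first-rank = cong suc (sym (cong length (Listₚ.filter-none (ℕ._<? b) (tabulate nothing-below))))
      where
      nothing-below : ∀ {y} → y ∈ a → ¬ y < b
      nothing-below y∈ y<b with covered y∈
      ... | here refl = ℕₚ.<-irrefl refl y<b
      ... | there y∈cs = ℕₚ.<-asym y<b (All.lookup b<cs y∈cs)

  Park-pairWith1 : Park w ≡ map (rank a) a
  Park-pairWith1 with assignList-ranked (distinctSortedℕ a) (distinctSortedℕ-sorted a) (∈-distinctSortedℕ⁺ a) (∈-distinctSortedℕ⁻ a)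
  ... | key∈ , ranked = begin
    map (look (assign w)) w                                              ≡⟨ cong (λ q → map (look q) w) (assign≡assignList w) ⟩
    map (look (assignList w (distinctSorted w))) w                      ≡⟨ cong (λ q → map (look (assignList w q)) w) (distinctSorted-pairWith1 a) ⟩
    map (look E) w                                                       ≡⟨ Listₚ.map-∘ a ⟨
    map (look E ∘ pairWith1) a                                           ≡⟨ Listₚ.map-cong-local (tabulate (λ x∈ → look-correct V E _ ranked (key∈ x∈))) ⟩
    map (rank a) a                                                       ∎
    where
    open ≡-Reasoning
    E = assignList w (map pairWith1 (distinctSortedℕ a))
    V : ℕ × ℕ → ℕ
    V k = rank a (proj₁ k)

zipPair-ones : ∀ a n → length a ≡ n → zipPair a (replicate n 1) ≡ map pairWith1 a
zipPair-ones [] zero _ = refl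
zipPair-ones (x ∷ a) (suc n) e = cong ((x , 1) ∷_) (zipPair-ones a n (ℕₚ.suc-injective e))

ParkPair-zip-ones : ∀ a n → length a ≡ n → ParkPair (zipPair a (replicate n 1)) ≡ map (rank a) a
ParkPair-zip-ones a n e = trans (cong ParkPair (zipPair-ones a n e)) (ParkWithOnes.Park-pairWith1 a)

rank-injective : ∀ π {x y} → x ∈ π → y ∈ π → rank π x ≡ rank π y → x ≡ y
rank-injective π {x} {y} x∈ y∈ e with ℕₚ.<-cmp x y
... | tri≈ _ x≡y _ = x≡y
... | tri< x<y _ _ = ⊥-elim (ℕₚ.<-irrefl refl (ℕₚ.≤-trans (countLt-< π x∈ x<y) (ℕₚ.≤-reflexive (sym (ℕₚ.suc-injective e)))))
... | tri> _ _ y<x = ⊥-elim (ℕₚ.<-irrefl refl (ℕₚ.≤-trans (countLt-< π y∈ y<x) (ℕₚ.≤-reflexive (ℕₚ.suc-injective e))))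

map-injective-on : ∀ (g : ℕ → ℕ) π (a b : Word) → (∀ {x y} → x ∈ π → y ∈ π → g x ≡ g y → x ≡ y) →
                   (∀ {x} → x ∈ a → x ∈ π) → (∀ {x} → x ∈ b → x ∈ π) → map g a ≡ map g b → a ≡ b
map-injective-on g π [] [] _ _ _ _ = refl
map-injective-on g π (x ∷ a) (y ∷ b) inj a⊆π b⊆π e =
  cong₂ _∷_ (inj (a⊆π (here refl)) (b⊆π (here refl)) (Listₚ.∷-injectiveˡ e)) (map-injective-on g π a b inj (a⊆π ∘ there) (b⊆π ∘ there) (Listₚ.∷-injectiveʳ e))

coeff-✶-F : ∀ x b w → All (λ p → length (proj₂ p) ≡ length b) x →
            coeff (x ✶ F b) w ≡ coeff (map (λ p → (proj₁ p , ParkPair (zipPair (proj₂ p) b))) x) w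
coeff-✶-F [] b w _ = refl
coeff-✶-F ((c , a) ∷ x) b w (same-length ∷ rest) = begin
  coeff (term (length a ℕ.≟ length b) ++ x ✶ F b) w        ≡⟨ coeff-++ (term (length a ℕ.≟ length b)) (x ✶ F b) w ⟩
  coeff (term (length a ℕ.≟ length b)) w +ℤ coeff (x ✶ F b) w ≡⟨ cong₂ _+ℤ_ (coeff-term (length a ℕ.≟ length b)) (coeff-✶-F x b w rest) ⟩
  coeff F′ w +ℤ coeff tail w                                    ≡⟨ coeff-++ F′ tail w ⟨
  coeff (F′ ++ tail) w                                          ∎
  where
  open ≡-Reasoning
  F′ = (c , ParkPair (zipPair a b)) ∷ []
  tail = map (λ p → (proj₁ p , ParkPair (zipPair (proj₂ p) b))) x
  term : Dec (length a ≡ length b) → Lin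
  term d = (if does d then (c *ℤ 1ℤ , ParkPair (zipPair a b)) ∷ [] else []) ++ []
  coeff-term : ∀ d → coeff (term d) w ≡ coeff F′ w
  coeff-term (yes _) = cong (λ q → coeff ((q , ParkPair (zipPair a b)) ∷ []) w) (ℤₚ.*-identityʳ c)
  coeff-term (no ≢) = ⊥-elim (≢ same-length)

coeff-P✶J : ∀ π n → length π ≡ n → ∀ w → coeff (P π ✶ J n) w ≡ indicator (w ∈? perms (map (rank π) π))
coeff-P✶J π n π-length w rewrite J≡F-ones n = begin
  coeff (P π ✶ F ones-n) w
    ≡⟨ coeff-✶-F (P π) ones-n w (Allₚ.map⁺ (tabulate (λ a∈ → trans (length-∈D a∈) (sym (Listₚ.length-replicate n))))) ⟩
  coeff (map (λ p → (proj₁ p , ParkPair (zipPair (proj₂ p) ones-n))) (sumF D)) w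
    ≡⟨ cong (λ q → coeff q w) (trans (sym (Listₚ.map-∘ D)) (trans (Listₚ.map-cong-local (tabulate park)) (Listₚ.map-∘ D))) ⟩
  multiplicity w (map (map g) D)
    ≡⟨ multiplicity-unique w (map (map g) D) (map-unique-locally-injective (map g) (UniqueDecₚ.deduplicate-! _≟W_ (perms π)) injective) ⟩
  indicator (w ∈? map (map g) D)
    ≡⟨ indicator-cong (w ∈? map (map g) D) (w ∈? perms (map g π)) to-perms from-perms ⟩
  indicator (w ∈? perms (map g π))
    ∎
  where
  open ≡-Reasoning
  ones-n = replicate n 1
  D = deduplicate _≟W_ (perms π)
  g = rank π
  ∈D⇒↭ : ∀ {a} → a ∈ D → a ↭ π
  ∈D⇒↭ a∈ = ∈-perms⇒↭ π (∈-deduplicate⁻ _≟W_ (perms π) a∈)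
  length-∈D : ∀ {a} → a ∈ D → length a ≡ n
  length-∈D a∈ = trans (↭ₚ.↭-length (∈D⇒↭ a∈)) π-length
  park : ∀ {a} → a ∈ D → (1ℤ , ParkPair (zipPair a ones-n)) ≡ (1ℤ , map g a)
  park {a} a∈ = cong (1ℤ ,_) (trans (ParkPair-zip-ones a n (length-∈D a∈)) (Listₚ.map-cong (λ x → cong suc (countLt-↭ x (∈D⇒↭ a∈))) a))
  injective : ∀ {a a′} → a ∈ D → a′ ∈ D → map g a ≡ map g a′ → a ≡ a′
  injective a∈ a′∈ = map-injective-on g π _ _ (rank-injective π) (↭ₚ.∈-resp-↭ (∈D⇒↭ a∈)) (↭ₚ.∈-resp-↭ (∈D⇒↭ a′∈))
  to-perms : w ∈ map (map g) D → w ∈ perms (map g π)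
  to-perms m with ∈-map⁻ (map g) m
  ... | a , a∈ , refl = ↭⇒∈-perms (map g π) (↭ₚ.map⁺ g (∈D⇒↭ a∈))
  from-perms : w ∈ perms (map g π) → w ∈ map (map g) D
  from-perms m with ↭ₚ.↭-map-inv g (↭-sym (∈-perms⇒↭ (map g π) m))
  ... | a , refl , π↭a = ∈-map⁺ (map g) (∈-deduplicate⁺ _≟W_ (↭⇒∈-perms π (↭-sym π↭a)))

standardise-fromEvFrom : ∀ K k m → map (λ x → m + countLt x (fromEvFrom k (blockEv K))) (fromEvFrom k (blockEv K)) ≡ piFrom m (parts K)
standardise-fromEvFrom [] k m = refl
standardise-fromEvFrom ((c , z) ∷ K) k m rewrite fromEvFrom-zeros (suc k) z (blockEv K) =
  trans (Listₚ.map-++ std (replicate c k) W)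
    (cong₂ _++_ (trans (Listₚ.map-replicate std c k) (cong (replicate c) std-k))
      (trans (Listₚ.map-cong-local (tabulate std-W)) (standardise-fromEvFrom K (suc k + z) (m + c))))
  where
  W = fromEvFrom (suc k + z) (blockEv K)
  std = λ x → m + countLt x (replicate c k ++ W)
  k<W : All (suc k ≤_) W
  k<W = All.map (ℕₚ.≤-trans (ℕₚ.m≤m+n (suc k) z)) (fromEvFrom-≥ (suc k + z) (blockEv K))
  std-k : std k ≡ m
  std-k = trans (cong (m +_) (trans (countLt-++ k (replicate c k) W)
                  (cong₂ _+_ (countLt-replicate-≥ k c k ℕₚ.≤-refl) (countLt-all-≥ k W (All.map ℕₚ.<⇒≤ k<W)))))
                (ℕₚ.+-identityʳ m)
  std-W : ∀ {x} → x ∈ W → std x ≡ (m + c) + countLt x W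
  std-W x∈ = trans (cong (m +_) (trans (countLt-++ _ (replicate c k) W) (cong (_+ countLt _ W) (countLt-replicate-< _ c k (All.lookup k<W x∈)))))
                   (sym (ℕₚ.+-assoc m c _))

map-rank-blockWord : ∀ K → map (rank (blockWord K)) (blockWord K) ≡ piFrom 1 (parts K)
map-rank-blockWord K = standardise-fromEvFrom K 1 1

length-fromEvFrom : ∀ k v → length (fromEvFrom k v) ≡ sum v
length-fromEvFrom k [] = refl
length-fromEvFrom k (e ∷ v) = trans (Listₚ.length-++ (replicate e k)) (cong₂ _+_ (Listₚ.length-replicate e) (length-fromEvFrom (suc k) v))

sum-zeros : ∀ z → sum (replicate z 0) ≡ 0
sum-zeros zero = refl
sum-zeros (suc z) = sum-zeros z

sum-blockEv : ∀ K → sum (blockEv K) ≡ sum (parts K)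
sum-blockEv [] = refl
sum-blockEv ((c , z) ∷ K) = cong (c +_) (trans (ℕᴸₚ.sum-++ (replicate z 0) (blockEv K)) (cong₂ _+_ (sum-zeros z) (sum-blockEv K)))

length-blockWord : ∀ K → length (blockWord K) ≡ sum (parts K)
length-blockWord K = trans (length-fromEvFrom 1 (blockEv K)) (sum-blockEv K)

length≤sum : ∀ I → All (1 ≤_) I → length I ≤ sum I
length≤sum [] [] = z≤n
length≤sum (c ∷ I) (1≤c ∷ pos) = ℕₚ.+-mono-≤ 1≤c (length≤sum I pos)

sum-parts-CoarseningFrom : ∀ {x r N} → CoarseningFrom x r N → sum (parts N) ≡ proj₁ x + sum (parts r)
sum-parts-CoarseningFrom end = refl
sum-parts-CoarseningFrom {x} (cut p) = cong (proj₁ x +_) (sum-parts-CoarseningFrom p)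
sum-parts-CoarseningFrom {x} {y ∷ r} (merge p) = trans (sum-parts-CoarseningFrom p) (ℕₚ.+-assoc (proj₁ x) (proj₁ y) _)

sum-parts-Coarsening : ∀ K {N} → Coarsening K N → sum (parts N) ≡ sum (parts K)
sum-parts-Coarsening [] refl = refl
sum-parts-Coarsening (x ∷ r) p = sum-parts-CoarseningFrom p

length≤suc-length-blockWord : ∀ K → Positive K → length K ≤ suc (length (blockWord K))
length≤suc-length-blockWord K pos = ℕₚ.m≤n⇒m≤1+n (begin
  length K            ≡⟨ Listₚ.length-map proj₁ K ⟨
  length (parts K)    ≤⟨ length≤sum (parts K) (Positive⇒parts-positive K pos) ⟩
  sum (parts K)       ≡⟨ length-blockWord K ⟨
  length (blockWord K) ∎)
  where open ℕₚ.≤-Reasoning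

length≤suc-length-parts : ∀ K → length K ≤ suc (length (parts K))
length≤suc-length-parts K = ℕₚ.m≤n⇒m≤1+n (ℕₚ.≤-reflexive (sym (Listₚ.length-map proj₁ K)))

Rib✶J≈jR-blockWord : ∀ K → Positive K → ∀ w → coeff (Rib (blockWord K) ✶ J (length (blockWord K))) w ≡ coeff (j (RSym (parts K))) w
Rib✶J≈jR-blockWord K pos = RibbonTransfer.Φ-Rf≈j-RSf (_✶ J n) (✶-isLinearˡ (J n)) HasSize size-Coarsening P✶J≈jS
  n (length (parts K)) K pos (sym (length-blockWord K)) (length≤suc-length-blockWord K pos) (length≤suc-length-parts K)
  where
  n = length (blockWord K)
  HasSize : List Block → Set
  HasSize N = sum (parts N) ≡ n
  size-Coarsening : ∀ K′ N → Positive K′ → HasSize K′ → Coarsening K′ N → HasSize N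
  size-Coarsening K′ N _ size c = trans (sum-parts-Coarsening K′ c) size
  P✶J≈jS : ∀ K′ → Positive K′ → HasSize K′ → ∀ w → coeff (P (blockWord K′) ✶ J n) w ≡ coeff (jS (parts K′)) w
  P✶J≈jS K′ pos′ size w = begin
    coeff (P (blockWord K′) ✶ J n) w                                 ≡⟨ coeff-P✶J (blockWord K′) n (trans (length-blockWord K′) size) w ⟩
    indicator (w ∈? perms (map (rank (blockWord K′)) (blockWord K′))) ≡⟨ cong (λ u → indicator (w ∈? perms u)) (map-rank-blockWord K′) ⟩
    indicator (w ∈? perms (piFrom 1 (parts K′)))                      ≡⟨ coeff-jS (parts K′) (Positive⇒parts-positive K′ pos′) w ⟨
    coeff (jS (parts K′)) w                                           ∎
    where open ≡-Reasoning

-- Every block but the last has z = c ∸ 1: the shape of the fully unpacked evaluation vector.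
Unpacked : List Block → Set
Unpacked [] = ⊤
Unpacked (_ ∷ []) = ⊤
Unpacked ((c , z) ∷ b ∷ K) = (z ≡ c ∸ 1) × Unpacked (b ∷ K)

fromEvFrom-Unpacked : ∀ K k → Positive K → Unpacked K → fromEvFrom k (blockEv K) ≡ piFrom k (parts K)
fromEvFrom-Unpacked [] k _ _ = refl
fromEvFrom-Unpacked ((c , z) ∷ []) k _ _ = cong (replicate c k ++_) (fromEvFrom-zeros (suc k) z [])
fromEvFrom-Unpacked ((suc c , z) ∷ b ∷ K) k (s≤s z≤n ∷ pos) (refl , unpacked) = cong (replicate (suc c) k ++_) (begin
  fromEvFrom (suc k) (replicate c 0 ++ blockEv (b ∷ K))  ≡⟨ fromEvFrom-zeros (suc k) c (blockEv (b ∷ K)) ⟩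
  fromEvFrom (suc k + c) (blockEv (b ∷ K))               ≡⟨ cong (λ q → fromEvFrom q (blockEv (b ∷ K))) (ℕₚ.+-suc k c) ⟨
  fromEvFrom (k + suc c) (blockEv (b ∷ K))               ≡⟨ fromEvFrom-Unpacked (b ∷ K) (k + suc c) pos unpacked ⟩
  piFrom (k + suc c) (parts (b ∷ K))                     ∎)
  where open ≡-Reasoning

Unpacked-⊕ : ∀ {c z c′ z′} → 1 ≤ c → 1 ≤ c′ → z ≡ c ∸ 1 → z′ ≡ c′ ∸ 1 → z + suc z′ ≡ (c + c′) ∸ 1
Unpacked-⊕ {suc c} {_} {suc c′} _ _ refl refl = refl

Unpacked-CoarseningFrom : ∀ {x r N} → 1 ≤ proj₁ x → Positive r → Unpacked (x ∷ r) → CoarseningFrom x r N → Unpacked N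
Unpacked-CoarseningFrom _ _ _ end = tt
Unpacked-CoarseningFrom px (py ∷ pr) (zx , unpacked) (cut p) with CoarseningFrom⇒∷ p
... | _ , _ , refl = zx , Unpacked-CoarseningFrom py pr unpacked p
Unpacked-CoarseningFrom px (py ∷ []) _ (merge p) = Unpacked-CoarseningFrom (ℕₚ.≤-trans px (ℕₚ.m≤m+n _ _)) [] tt p
Unpacked-CoarseningFrom px (py ∷ pq ∷ pr) (zx , zy , unpacked) (merge p) =
  Unpacked-CoarseningFrom (ℕₚ.≤-trans px (ℕₚ.m≤m+n _ _)) (pq ∷ pr) (Unpacked-⊕ px py zx zy , unpacked) p

Unpacked-Coarsening : ∀ K N → Positive K → Unpacked K → Coarsening K N → Unpacked N
Unpacked-Coarsening [] N _ _ refl = tt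
Unpacked-Coarsening (x ∷ r) N (px ∷ pr) unpacked c = Unpacked-CoarseningFrom px pr unpacked c

unpackedBlocks : List ℕ → List Block
unpackedBlocks = map (λ c → (c , c ∸ 1))

parts-unpackedBlocks : ∀ I → parts (unpackedBlocks I) ≡ I
parts-unpackedBlocks I = trans (sym (Listₚ.map-∘ I)) (Listₚ.map-id I)

unpackedBlocks-positive : ∀ I → All (1 ≤_) I → Positive (unpackedBlocks I)
unpackedBlocks-positive I pos = Allₚ.map⁺ pos

unpackedBlocks-Unpacked : ∀ I → Unpacked (unpackedBlocks I)
unpackedBlocks-Unpacked [] = tt
unpackedBlocks-Unpacked (c ∷ []) = tt
unpackedBlocks-Unpacked (c ∷ d ∷ I) = refl , unpackedBlocks-Unpacked (d ∷ I)

fromEvFrom-unpack : ∀ k I → All (1 ≤_) I → fromEvFrom k (unpack I) ≡ piFrom k I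
fromEvFrom-unpack k [] _ = refl
fromEvFrom-unpack k (c ∷ []) _ = refl
fromEvFrom-unpack k (suc c ∷ d ∷ I) (_ ∷ pos) = cong (replicate (suc c) k ++_) (begin
  fromEvFrom (suc k) (replicate c 0 ++ unpack (d ∷ I))  ≡⟨ fromEvFrom-zeros (suc k) c (unpack (d ∷ I)) ⟩
  fromEvFrom (suc k + c) (unpack (d ∷ I))               ≡⟨ cong (λ q → fromEvFrom q (unpack (d ∷ I))) (ℕₚ.+-suc k c) ⟨
  fromEvFrom (k + suc c) (unpack (d ∷ I))               ≡⟨ fromEvFrom-unpack (k + suc c) (d ∷ I) pos ⟩
  piFrom (k + suc c) (d ∷ I)                            ∎)
  where open ≡-Reasoning

piI≡blockWord-unpackedBlocks : ∀ I → All (1 ≤_) I → piI I ≡ blockWord (unpackedBlocks I)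
piI≡blockWord-unpackedBlocks I pos = begin
  fromEv (unpack I)                    ≡⟨ fromEvFrom-unpack 1 I pos ⟩
  piFrom 1 I                           ≡⟨ cong (piFrom 1) (parts-unpackedBlocks I) ⟨
  piFrom 1 (parts K)                   ≡⟨ fromEvFrom-Unpacked K 1 (unpackedBlocks-positive I pos) (unpackedBlocks-Unpacked I) ⟨
  blockWord K                          ∎
  where
  open ≡-Reasoning
  K = unpackedBlocks I

jR≈Rib-piI : ∀ I → All (1 ≤_) I → ∀ w → coeff (j (RSym I)) w ≡ coeff (Rib (piI I)) w
jR≈Rib-piI I pos w rewrite piI≡blockWord-unpackedBlocks I pos =
  subst (λ I′ → coeff (j (RSf (length I′) I′)) w ≡ coeff (Rib (blockWord K)) w) (parts-unpackedBlocks I)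
    (sym (RibbonTransfer.Φ-Rf≈j-RSf (λ x → x) id-isLinear Unpacked Unpacked-Coarsening P≈jS
      (length (blockWord K)) (length (parts K)) K posK (unpackedBlocks-Unpacked I)
      (length≤suc-length-blockWord K posK) (length≤suc-length-parts K) w))
  where
  K = unpackedBlocks I
  posK = unpackedBlocks-positive I pos
  P≈jS : ∀ K′ → Positive K′ → Unpacked K′ → ∀ w → coeff (P (blockWord K′)) w ≡ coeff (jS (parts K′)) w
  P≈jS K′ pos′ unpacked w = begin
    coeff (P (blockWord K′)) w                    ≡⟨ coeff-P (blockWord K′) w ⟩
    indicator (w ∈? perms (blockWord K′))         ≡⟨ cong (λ u → indicator (w ∈? perms u)) (fromEvFrom-Unpacked K′ 1 pos′ unpacked) ⟩
    indicator (w ∈? perms (piFrom 1 (parts K′)))  ≡⟨ coeff-jS (parts K′) (Positive⇒parts-positive K′ pos′) w ⟨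
    coeff (jS (parts K′)) w                       ∎
    where open ≡-Reasoning

mainTheorem7 : ∀ (π : Word) → IsNDPF π →
    (Rib π ✶ J (length π) ≈ j (RSym (nonzeros (Ev π))))
    × (j (RSym (nonzeros (Ev π))) ≈ Rib (piI (nonzeros (Ev π))))
mainTheorem7 π ndpf with NDPF⇒blockWord π ndpf
... | K , pos , refl rewrite composition-blockWord K pos =
  Rib✶J≈jR-blockWord K pos , jR≈Rib-piI (parts K) (Positive⇒parts-positive K pos)
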